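{- Let $a,b$ be positive integers, let $0\le k\le b-1$ (with $k=0$ if $a=1$), and let $\mu_1,\mu_2\in\mathsf{H}_{\delta(k)}(a,b)$. Let $(s_1,t_1)$ and $(s_2,t_2)$ be their simplified $\widehat\nu(k)$-bracket vectors. Then $\mu_1\le\mu_2$ in $\mathsf{H}_{\delta(k)}(a,b)$ if and only if $s_1\le s_2$ and $t_1\le t_2$.
   Context: A lattice path is a finite word in $N$ (unit north step) and $E$ (unit east step), drawn from the origin; exponents denote repetition. For $\nu=E^{\nu_0}NE^{\nu_1}N\cdots NE^{\nu_n}$, a $\nu$-path is a lattice path with the same endpoints as $\nu$ that stays weakly above $\nu$. An increment vector is an integer vector $\delta=(\delta_1,\dots,\delta_n)$ with $0\le\delta_i\le\nu_i$. The $\delta$-altitude along a $\nu$-path $\mu$ is $0$ at the start, decreases by $1$ after each $E$ step, and increases by $\delta_i$ after the $i$th $N$ step. A $\delta$-rotation at a valley $EN$ is defined as follows. Let $x$ be the point between the $E$ and $N$, and let $y$ be the first later point with the same $\delta$-altitude as $x$. Interchange the subpath from $x$ to $y$ with the $E$ step preceding $x$; this gives $\mu'$. The alt $\nu$-Tamari lattice $\mathrm{Tam}_\delta(\nu)$ is the poset on $\nu$-paths whose cover relations are the $\delta$-rotations $\mu\lessdot\mu'$. Set $\nu=EN^{a-1}E^{b-1}N$. If $a>1$, the increment vectors are $\delta(k)=(0,\dots,0,k,0)\in\mathbb{Z}^a$ for $0\le k\le b-1$. If $a=1$, the only one is $\delta(0)=(0)$. Write $\mathsf{H}_{\delta(k)}(a,b)=\mathrm{Tam}_{\delta(k)}(\nu)$.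 Let $\widehat\nu(k)=E^{b-k}N^{a-1}E^kN$ if $a>1$, and $\widehat\nu(0)=E^bN$ if $a=1$. Bracket vectors: for a lattice path $\rho$ from $(0,0)$ to $(r-n,n)$, let $\mathbf a(\rho)=(a_0,\dots,a_r)$ list the $y$-coordinates of its lattice points in order. The fixed positions are $f_i=\max\{j: a_j=i\}$. For a $\rho$-path $\mu$, its $\rho$-bracket vector $\mathbf b(\mu)$ is built as follows: set $b_{f_i}=i$; then for $i=0,\dots,n$ in turn, with $g_i$ the number of entries $i$ in $\mathbf a(\mu)$, assign $i$ to the first $g_i-1$ unassigned positions to the left of $f_i$, scanning from right to left. For $\mu\in\mathsf{H}_{\delta(k)}(a,b)$, the $\widehat\nu(k)$-bracket vector has the form $(\alpha,s,\underline0,\underline1,\dots,\underline{a-2},\beta,\underline{a-1},\underline a)$ if $a>1$, where $(\alpha,\beta)$ consists of $t$ entries $a$ followed by entries $a-1$. It has the form $(\gamma,s,\underline0,\underline1)$ if $a=1$, where $\gamma$ consists of $t$ entries $1$ followed by $0$'s. Underlined entries are the fixed positions. The simplified bracket vector of $\mu$ is the pair $(s,t)$: $s$ is the entry immediately before the fixed position $\underline0$, and $t$ is the number of entries equal to $a$ (resp. $1$) among the non-fixed entries other than $s$. -}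

module Defs where

open import Data.Nat using (ℕ; zero; suc; _∸_; _≡ᵇ_; _≤_)
open import Data.Integer as ℤ using (ℤ; +_)
open import Data.Bool using (Bool; true; false; if_then_else_; _∧_; _∨_; not)
open import Data.List using (List; []; _∷_; _++_; replicate; foldl; upTo; reverse; take; drop; length)
open import Data.List.Relation.Unary.All using (All)
open import Data.List.Relation.Unary.Any using (Any)
open import Data.Bool.ListAction using (any)
open import Data.Maybe using (Maybe; just; nothing; fromMaybe)
open import Data.Product using (_×_; _,_; Σ-syntax; ∃-syntax)
open import Relation.Binary.PropositionalEquality using (_≡_; _≢_)
open import Relation.Binary.Construct.Closure.ReflexiveTransitive using (Star)

data Step : Set where
  E N : Step

Path : Set
Path = List Step

countE : Path → ℕ
countE []      = 0
countE (E ∷ p) = suc (countE p)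
countE (N ∷ p) = countE p

countN : Path → ℕ
countN []      = 0
countN (E ∷ p) = countN p
countN (N ∷ p) = suc (countN p)

pointsFrom : ℕ → ℕ → Path → List (ℕ × ℕ)
pointsFrom x y []      = []
pointsFrom x y (E ∷ p) = (suc x , y) ∷ pointsFrom (suc x) y p
pointsFrom x y (N ∷ p) = (x , suc y) ∷ pointsFrom x (suc y) p

points : Path → List (ℕ × ℕ)
points p = (0 , 0) ∷ pointsFrom 0 0 p

-- μ is a ν-path: same endpoints as ν, and every lattice point (x , y) of μ
-- lies weakly above ν, i.e. ν has a lattice point (x , y') with y' ≤ y.
IsNuPath : Path → Path → Set
IsNuPath ν μ =
  countE μ ≡ countE ν × countN μ ≡ countN ν ×
  All (λ { (x , y) → Any (λ { (x' , y') → x' ≡ x × y' ≤ y }) (points ν) }) (points μ)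

-- δ-altitude and δ-rotations.  An increment vector is given as a function
-- δ : ℕ → ℕ, where δ i is the increment of the i-th N step (i ≥ 1).

-- altitude at the end of a path, where c N steps have already been taken
altFrom : (ℕ → ℕ) → ℕ → Path → ℤ
altFrom δ c []      = + 0
altFrom δ c (E ∷ p) = ℤ.-[1+ 0 ] ℤ.+ altFrom δ c p
altFrom δ c (N ∷ p) = (+ δ (suc c)) ℤ.+ altFrom δ (suc c) p

alt : (ℕ → ℕ) → Path → ℤ
alt δ p = altFrom δ 0 p

-- μ ⋖ μ' by a δ-rotation:  μ = u E w v  where the point x between the E and
-- the first step of w (which is N, so EN is a valley) and y (end of w) is the
-- first later point with the same altitude as x;  μ' = u w E v.
Rot : (ℕ → ℕ) → Path → Path → Set
Rot δ μ μ' =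
  Σ[ u ∈ Path ] Σ[ w ∈ Path ] Σ[ v ∈ Path ]
    ( μ ≡ u ++ E ∷ w ++ v
    × (Σ[ w₀ ∈ Path ] w ≡ N ∷ w₀)
    × alt δ (u ++ E ∷ w) ≡ alt δ (u ++ E ∷ [])
    × (∀ w₁ w₂ → w ≡ w₁ ++ w₂ → w₁ ≢ [] → w₂ ≢ [] →
         alt δ (u ++ E ∷ w₁) ≢ alt δ (u ++ E ∷ []))
    × μ' ≡ u ++ w ++ E ∷ v )

nu : ℕ → ℕ → Path
nu a b = E ∷ replicate (a ∸ 1) N ++ replicate (b ∸ 1) E ++ N ∷ []

-- δ(k) = (0,…,0,k,0) ∈ ℤ^a  (k in coordinate a-1); for a = 1 (and k = 0)
-- no coordinate has index a-1 = 0, so this is δ(0) = (0).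
deltaK : ℕ → ℕ → (ℕ → ℕ)
deltaK a k i = if i ≡ᵇ (a ∸ 1) then k else 0

HCover : ℕ → ℕ → ℕ → Path → Path → Set
HCover a b k μ μ' = IsNuPath (nu a b) μ × IsNuPath (nu a b) μ' × Rot (deltaK a k) μ μ'

HLeq : ℕ → ℕ → ℕ → Path → Path → Set
HLeq a b k = Star (HCover a b k)

nuHat : ℕ → ℕ → ℕ → Path
nuHat a b k = replicate (b ∸ k) E ++ replicate (a ∸ 1) N ++ replicate k E ++ N ∷ []

ys : Path → List ℕ
ys p = Data.List.map (λ { (x , y) → y }) (points p)
  where import Data.List

-- max { j : xs_j = i } (0 if absent, which never happens for 0 ≤ i ≤ n)
lastIdxFrom : ℕ → ℕ → List ℕ → ℕ → ℕ
lastIdxFrom i j []       acc = acc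
lastIdxFrom i j (x ∷ xs) acc = lastIdxFrom i (suc j) xs (if x ≡ᵇ i then j else acc)

fixedPos : Path → ℕ → ℕ
fixedPos ρ i = lastIdxFrom i 0 (ys ρ) 0

countVal : ℕ → List ℕ → ℕ
countVal i []       = 0
countVal i (x ∷ xs) = if x ≡ᵇ i then suc (countVal i xs) else countVal i xs

setAt : {A : Set} → ℕ → A → List A → List A
setAt j a []             = []
setAt zero a (x ∷ xs)    = a ∷ xs
setAt (suc j) a (x ∷ xs) = x ∷ setAt j a xs

fill : ℕ → ℕ → List (Maybe ℕ) → List (Maybe ℕ)
fill v zero    xs             = xs
fill v (suc c) []             = []
fill v (suc c) (nothing ∷ xs) = just v ∷ fill v c xs
fill v (suc c) (just x ∷ xs)  = just x ∷ fill v (suc c) xs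

-- assign v to the first c unassigned positions to the left of f,
-- scanning from right to left
fillLeft : ℕ → ℕ → ℕ → List (Maybe ℕ) → List (Maybe ℕ)
fillLeft v c f b = reverse (fill v c (reverse (take f b))) ++ drop f b

initBracket : Path → List (Maybe ℕ)
initBracket ρ =
  foldl (λ b i → setAt (fixedPos ρ i) (just i) b)
        (replicate (suc (length ρ)) nothing)
        (upTo (suc (countN ρ)))

-- ρ-bracket vector of the ρ-path μ (all entries get assigned for ρ-paths;
-- fromMaybe 0 is only a totality default)
bracket : Path → Path → List ℕ
bracket ρ μ =
  Data.List.map (fromMaybe 0)
    (foldl (λ b i → fillLeft i (countVal i (ys μ) ∸ 1) (fixedPos ρ i) b)
           (initBracket ρ)
           (upTo (suc (countN ρ))))
  where import Data.List

nth : ℕ → List ℕ → ℕ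
nth j []             = 0
nth zero (x ∷ xs)    = x
nth (suc j) (x ∷ xs) = nth j xs

isFixed : Path → ℕ → Bool
isFixed ρ j = any (λ i → fixedPos ρ i ≡ᵇ j) (upTo (suc (countN ρ)))

simpS : ℕ → ℕ → ℕ → Path → ℕ
simpS a b k μ = nth (fixedPos (nuHat a b k) 0 ∸ 1) (bracket (nuHat a b k) μ)

countT : Path → ℕ → ℕ → ℕ → List ℕ → ℕ
countT ρ a sPos j []       = 0
countT ρ a sPos j (x ∷ xs) =
  (if not (isFixed ρ j) ∧ not (j ≡ᵇ sPos) ∧ (x ≡ᵇ a)
     then suc (countT ρ a sPos (suc j) xs)
     else countT ρ a sPos (suc j) xs)

simpT : ℕ → ℕ → ℕ → Path → ℕ
simpT a b k μ =
  countT (nuHat a b k) a (fixedPos (nuHat a b k) 0 ∸ 1) 0 (bracket (nuHat a b k) μ)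

-- With A = a - 1 and B = b - 1 = C + k, the ν-paths are the zigzags N^p E N^q E^r N E^e
-- (q + p = A, r + e = B) and the top path N^a E^b.  Counting the lattice points at each height gives
-- their ν̂(k)-bracket vectors: the simplified vector (s, t) is (p, e) when q > 0, (A, e) when q = 0 and
-- k ≤ r, (a, e - 1) when q = 0 and r < k, and (a, B) for the top path.  A rotation moves an E step to
-- the right, so it never decreases the number of leading N steps nor that of trailing E steps; since
-- moreover no rotation leads from a zigzag with q > 0 to the one with q = 0 and the same r < k, (s, t)
-- is monotone.  Conversely, below any target in the product order there is an explicit rotation that
-- stays below the target and decreases a potential, so the target is reached.

module Submission where

open import Defs
open import Data.Bool using (Bool; true; false; not; _∧_; _∨_; if_then_else_)
open import Data.Bool.ListAction using (any)
open import Data.Bool.Properties using (∨-assoc; ∨-zeroʳ; ∧-zeroʳ)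
open import Data.Empty using (⊥; ⊥-elim)
open import Data.Integer as ℤ using (-[1+_]) renaming (_+_ to _+ℤ_)
import Data.Integer.Properties as ℤ
open import Algebra.Properties.AbelianGroup ℤ.+-0-abelianGroup using (identityˡ-unique; identityʳ-unique)
open import Data.List using (List; []; _∷_; _++_; _∷ʳ_; replicate; reverse; take; drop; length; foldl; upTo; map)
open import Data.List.Properties
  using ( ++-assoc; ++-identityʳ; ++-cancelˡ; ++-conicalʳ; ∷-injective; reverse-++; unfold-reverse; reverse-involutive
        ; reverse-map; length-reverse; take++drop≡id; length-take; map-++; length-++; length-replicate; length-map
        ; length-upTo; upTo-∷ʳ; foldl-∷ʳ )
open import Data.List.Relation.Unary.All as All using (All; []; _∷_)
open import Data.List.Relation.Unary.All.Properties using (++⁺; ++⁻ʳ)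
open import Data.List.Relation.Unary.Any using (Any; here; there)
open import Data.List.Relation.Unary.Any.Properties using (++⁺ˡ; ++⁺ʳ)
open import Data.Maybe using (Maybe; just; nothing; fromMaybe)
open import Data.Nat using (ℕ; zero; suc; pred; _+_; _∸_; _⊓_; _≤_; _<_; _≡ᵇ_; z≤n; s≤s; s≤s⁻¹; _≤?_; _<?_)
open import Data.Nat.Properties
open import Data.Nat.Tactic.RingSolver using (solve-∀)
open import Data.Product using (Σ; Σ-syntax; _×_; _,_; proj₁; proj₂; map₂)
open import Data.Sum using (_⊎_; inj₁; inj₂)
open import Function using (_∘_)
open import Function.Bundles using (_⇔_; mk⇔)
open import Relation.Binary.Construct.Closure.ReflexiveTransitive using (ε; _◅_)
open import Relation.Binary.Definitions using (tri<; tri≈; tri>)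
open import Relation.Binary.PropositionalEquality
open import Relation.Nullary using (¬_; Dec; yes; no)
open ≡-Reasoning

private variable
  X : Set

replicate-+ : ∀ m n (x : X) → replicate (m + n) x ≡ replicate m x ++ replicate n x
replicate-+ zero    n x = refl
replicate-+ (suc m) n x = cong (x ∷_) (replicate-+ m n x)

replicate-∷ʳ : ∀ n (x : X) → replicate n x ∷ʳ x ≡ x ∷ replicate n x
replicate-∷ʳ zero    x = refl
replicate-∷ʳ (suc n) x = cong (x ∷_) (replicate-∷ʳ n x)

replicate-++-∷ : ∀ n (x : X) ys → replicate n x ++ x ∷ ys ≡ x ∷ replicate n x ++ ys
replicate-++-∷ n x ys = trans (sym (++-assoc (replicate n x) (x ∷ []) ys)) (cong (_++ ys) (replicate-∷ʳ n x))

reverse-replicate : ∀ n (x : X) → reverse (replicate n x) ≡ replicate n x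
reverse-replicate zero    x = refl
reverse-replicate (suc n) x = begin
  reverse (x ∷ replicate n x)   ≡⟨ unfold-reverse x (replicate n x) ⟩
  reverse (replicate n x) ∷ʳ x  ≡⟨ cong (_∷ʳ x) (reverse-replicate n x) ⟩
  replicate n x ∷ʳ x            ≡⟨ replicate-∷ʳ n x ⟩
  x ∷ replicate n x             ∎

take-length-++ : ∀ (xs ys : List X) → take (length xs) (xs ++ ys) ≡ xs
take-length-++ []       ys = refl
take-length-++ (x ∷ xs) ys = cong (x ∷_) (take-length-++ xs ys)

drop-length-++ : ∀ (xs ys : List X) → drop (length xs) (xs ++ ys) ≡ ys
drop-length-++ []       ys = refl
drop-length-++ (x ∷ xs) ys = drop-length-++ xs ys

≡ᵇ-refl : ∀ n → (n ≡ᵇ n) ≡ true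
≡ᵇ-refl zero    = refl
≡ᵇ-refl (suc n) = ≡ᵇ-refl n

≢⇒≡ᵇ≡false : ∀ {m n} → m ≢ n → (m ≡ᵇ n) ≡ false
≢⇒≡ᵇ≡false {zero}  {zero}  m≢n = ⊥-elim (m≢n refl)
≢⇒≡ᵇ≡false {zero}  {suc n} m≢n = refl
≢⇒≡ᵇ≡false {suc m} {zero}  m≢n = refl
≢⇒≡ᵇ≡false {suc m} {suc n} m≢n = ≢⇒≡ᵇ≡false (m≢n ∘ cong suc)

any-++ : ∀ (f : ℕ → Bool) xs zs → any f (xs ++ zs) ≡ (any f xs ∨ any f zs)
any-++ f []       zs = refl
any-++ f (x ∷ xs) zs = trans (cong (f x ∨_) (any-++ f xs zs)) (sym (∨-assoc (f x) _ _))

any-upTo-false : ∀ (f : ℕ → Bool) n → (∀ i → i < n → f i ≡ false) → any f (upTo n) ≡ false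
any-upTo-false f zero    h = refl
any-upTo-false f (suc n) h = begin
  any f (upTo (suc n))         ≡⟨ cong (any f) (sym (upTo-∷ʳ n)) ⟩
  any f (upTo n ++ n ∷ [])     ≡⟨ any-++ f (upTo n) (n ∷ []) ⟩
  any f (upTo n) ∨ (f n ∨ false) ≡⟨ cong₂ (λ b c → b ∨ (c ∨ false)) (any-upTo-false f n (λ i i<n → h i (m<n⇒m<1+n i<n))) (h n ≤-refl) ⟩
  false                        ∎

any-upTo-last : ∀ (f : ℕ → Bool) n → f n ≡ true → any f (upTo (suc n)) ≡ true
any-upTo-last f n fn = begin
  any f (upTo (suc n))         ≡⟨ cong (any f) (sym (upTo-∷ʳ n)) ⟩
  any f (upTo n ++ n ∷ [])     ≡⟨ any-++ f (upTo n) (n ∷ []) ⟩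
  any f (upTo n) ∨ (f n ∨ false) ≡⟨ cong (λ b → any f (upTo n) ∨ (b ∨ false)) fn ⟩
  any f (upTo n) ∨ true        ≡⟨ ∨-zeroʳ _ ⟩
  true                         ∎

setAt-length : ∀ (xs : List X) v y zs → setAt (length xs) v (xs ++ y ∷ zs) ≡ xs ++ v ∷ zs
setAt-length []       v y zs = refl
setAt-length (x ∷ xs) v y zs = cong (x ∷_) (setAt-length xs v y zs)

holes : ℕ → List (Maybe ℕ)
holes n = replicate n nothing

justs : List ℕ → List (Maybe ℕ)
justs = map just

fill-justs : ∀ v n zs xs → fill v n (justs zs ++ xs) ≡ justs zs ++ fill v n xs
fill-justs v zero    zs       xs = refl
fill-justs v (suc n) []       xs = refl
fill-justs v (suc n) (z ∷ zs) xs = cong (just z ∷_) (fill-justs v (suc n) zs xs)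

fill-holes-≤ : ∀ v n m xs → fill v n (holes (n + m) ++ xs) ≡ justs (replicate n v) ++ holes m ++ xs
fill-holes-≤ v zero    m xs = refl
fill-holes-≤ v (suc n) m xs = cong (just v ∷_) (fill-holes-≤ v n m xs)

fill-holes-≥ : ∀ v n m xs → fill v (m + n) (holes m ++ xs) ≡ justs (replicate m v) ++ fill v n xs
fill-holes-≥ v n zero    xs = refl
fill-holes-≥ v n (suc m) xs = cong (just v ∷_) (fill-holes-≥ v n m xs)

length-fill : ∀ v n xs → length (fill v n xs) ≡ length xs
length-fill v zero    xs             = refl
length-fill v (suc n) []             = refl
length-fill v (suc n) (nothing ∷ xs) = cong suc (length-fill v n xs)
length-fill v (suc n) (just x ∷ xs)  = cong suc (length-fill v (suc n) xs)

fillʳ : ℕ → ℕ → List (Maybe ℕ) → List (Maybe ℕ)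
fillʳ v n xs = reverse (fill v n (reverse xs))

fillLeft-++ : ∀ v n xs ys → fillLeft v n (length xs) (xs ++ ys) ≡ fillʳ v n xs ++ ys
fillLeft-++ v n xs ys =
  cong₂ (λ as bs → reverse (fill v n (reverse as)) ++ bs) (take-length-++ xs ys) (drop-length-++ xs ys)

fillLeft-zero : ∀ v f xs → fillLeft v 0 f xs ≡ xs
fillLeft-zero v f xs = trans (cong (_++ drop f xs) (reverse-involutive (take f xs))) (take++drop≡id f xs)

length-fillʳ : ∀ v n xs → length (fillʳ v n xs) ≡ length xs
length-fillʳ v n xs =
  trans (length-reverse (fill v n (reverse xs))) (trans (length-fill v n (reverse xs)) (length-reverse xs))

reverse-justs : ∀ zs → reverse (justs zs) ≡ justs (reverse zs)
reverse-justs zs = sym (reverse-map just zs)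

reverse-justs-replicate : ∀ n v → reverse (justs (replicate n v)) ≡ justs (replicate n v)
reverse-justs-replicate n v = trans (reverse-justs (replicate n v)) (cong justs (reverse-replicate n v))

fillʳ-justs : ∀ v n xs zs → fillʳ v n (xs ++ justs zs) ≡ fillʳ v n xs ++ justs zs
fillʳ-justs v n xs zs = begin
  reverse (fill v n (reverse (xs ++ justs zs)))
    ≡⟨ cong (λ ys → reverse (fill v n ys)) (trans (reverse-++ xs (justs zs)) (cong (_++ reverse xs) (reverse-justs zs))) ⟩
  reverse (fill v n (justs (reverse zs) ++ reverse xs))
    ≡⟨ cong reverse (fill-justs v n (reverse zs) (reverse xs)) ⟩
  reverse (justs (reverse zs) ++ fill v n (reverse xs))
    ≡⟨ reverse-++ (justs (reverse zs)) _ ⟩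
  fillʳ v n xs ++ reverse (justs (reverse zs))
    ≡⟨ cong (fillʳ v n xs ++_) (trans (reverse-justs (reverse zs)) (cong justs (reverse-involutive zs))) ⟩
  fillʳ v n xs ++ justs zs ∎

fillʳ-holes-≤ : ∀ v n m xs → fillʳ v n (xs ++ holes (m + n)) ≡ xs ++ holes m ++ justs (replicate n v)
fillʳ-holes-≤ v n m xs = begin
  reverse (fill v n (reverse (xs ++ holes (m + n))))
    ≡⟨ cong (λ ys → reverse (fill v n ys)) (trans (reverse-++ xs (holes (m + n)))
         (cong (_++ reverse xs) (trans (reverse-replicate (m + n) nothing) (cong holes (+-comm m n))))) ⟩
  reverse (fill v n (holes (n + m) ++ reverse xs))
    ≡⟨ cong reverse (fill-holes-≤ v n m (reverse xs)) ⟩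
  reverse (justs (replicate n v) ++ holes m ++ reverse xs)
    ≡⟨ reverse-++ (justs (replicate n v)) _ ⟩
  reverse (holes m ++ reverse xs) ++ reverse (justs (replicate n v))
    ≡⟨ cong₂ _++_ (reverse-++ (holes m) (reverse xs)) (reverse-justs-replicate n v) ⟩
  (reverse (reverse xs) ++ reverse (holes m)) ++ justs (replicate n v)
    ≡⟨ cong₂ (λ as bs → (as ++ bs) ++ justs (replicate n v)) (reverse-involutive xs) (reverse-replicate m nothing) ⟩
  (xs ++ holes m) ++ justs (replicate n v)
    ≡⟨ ++-assoc xs (holes m) _ ⟩
  xs ++ holes m ++ justs (replicate n v) ∎

fillʳ-holes-≥ : ∀ v n m xs → fillʳ v (m + n) (xs ++ holes m) ≡ fillʳ v n xs ++ justs (replicate m v)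
fillʳ-holes-≥ v n m xs = begin
  reverse (fill v (m + n) (reverse (xs ++ holes m)))
    ≡⟨ cong (λ ys → reverse (fill v (m + n) ys)) (trans (reverse-++ xs (holes m)) (cong (_++ reverse xs) (reverse-replicate m nothing))) ⟩
  reverse (fill v (m + n) (holes m ++ reverse xs))
    ≡⟨ cong reverse (fill-holes-≥ v n m (reverse xs)) ⟩
  reverse (justs (replicate m v) ++ fill v n (reverse xs))
    ≡⟨ reverse-++ (justs (replicate m v)) _ ⟩
  fillʳ v n xs ++ reverse (justs (replicate m v))
    ≡⟨ cong (fillʳ v n xs ++_) (reverse-justs-replicate m v) ⟩
  fillʳ v n xs ++ justs (replicate m v) ∎

fillʳ-all : ∀ v n zs → fillʳ v n (holes n ++ justs zs) ≡ justs (replicate n v ++ zs)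
fillʳ-all v n zs = begin
  fillʳ v n (holes n ++ justs zs)         ≡⟨ fillʳ-justs v n (holes n) zs ⟩
  fillʳ v n (holes n) ++ justs zs         ≡⟨ cong (_++ justs zs) (fillʳ-holes-≤ v n 0 []) ⟩
  justs (replicate n v) ++ justs zs       ≡⟨ sym (map-++ just (replicate n v) zs) ⟩
  justs (replicate n v ++ zs)             ∎

fillʳ-fillʳ-≤ : ∀ v w c d g W →
  fillʳ v (d + c) (fillʳ w g (holes c ++ justs W ++ holes (d + g))) ≡ justs (replicate c v ++ W ++ replicate d v ++ replicate g w)
fillʳ-fillʳ-≤ v w c d g W = begin
  fillʳ v (d + c) (fillʳ w g (holes c ++ justs W ++ holes (d + g)))
    ≡⟨ cong (λ xs → fillʳ v (d + c) (fillʳ w g xs)) (sym (++-assoc (holes c) (justs W) _)) ⟩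
  fillʳ v (d + c) (fillʳ w g (P ++ holes (d + g)))
    ≡⟨ cong (fillʳ v (d + c)) (trans (fillʳ-holes-≤ w g d P) (sym (++-assoc P (holes d) _))) ⟩
  fillʳ v (d + c) ((P ++ holes d) ++ justs (replicate g w))
    ≡⟨ fillʳ-justs v (d + c) (P ++ holes d) (replicate g w) ⟩
  fillʳ v (d + c) (P ++ holes d) ++ justs (replicate g w)
    ≡⟨ cong (_++ justs (replicate g w)) (fillʳ-holes-≥ v c d P) ⟩
  (fillʳ v c (holes c ++ justs W) ++ justs (replicate d v)) ++ justs (replicate g w)
    ≡⟨ cong (λ xs → (xs ++ justs (replicate d v)) ++ justs (replicate g w)) (fillʳ-all v c W) ⟩
  (justs (replicate c v ++ W) ++ justs (replicate d v)) ++ justs (replicate g w)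
    ≡⟨ trans (cong (_++ justs (replicate g w)) (sym (map-++ just (replicate c v ++ W) _))) (sym (map-++ just _ (replicate g w))) ⟩
  justs (((replicate c v ++ W) ++ replicate d v) ++ replicate g w)
    ≡⟨ cong justs (trans (++-assoc (replicate c v ++ W) _ _) (++-assoc (replicate c v) W _)) ⟩
  justs (replicate c v ++ W ++ replicate d v ++ replicate g w) ∎
  where P = holes c ++ justs W

fillʳ-fillʳ-≥ : ∀ v w s e k W →
  fillʳ v s (fillʳ w (k + e) (holes (s + e) ++ justs W ++ holes k)) ≡ justs (replicate s v ++ replicate e w ++ W ++ replicate k w)
fillʳ-fillʳ-≥ v w s e k W = begin
  fillʳ v s (fillʳ w (k + e) (holes (s + e) ++ justs W ++ holes k))
    ≡⟨ cong (λ xs → fillʳ v s (fillʳ w (k + e) xs)) (sym (++-assoc (holes (s + e)) (justs W) _)) ⟩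
  fillʳ v s (fillʳ w (k + e) ((holes (s + e) ++ justs W) ++ holes k))
    ≡⟨ cong (fillʳ v s) (fillʳ-holes-≥ w e k (holes (s + e) ++ justs W)) ⟩
  fillʳ v s (fillʳ w e (holes (s + e) ++ justs W) ++ justs (replicate k w))
    ≡⟨ cong (λ xs → fillʳ v s (xs ++ justs (replicate k w))) (trans (fillʳ-justs w e (holes (s + e)) W) (cong (_++ justs W) (fillʳ-holes-≤ w e s []))) ⟩
  fillʳ v s (((holes s ++ justs (replicate e w)) ++ justs W) ++ justs (replicate k w))
    ≡⟨ cong (fillʳ v s) reassoc ⟩
  fillʳ v s (holes s ++ justs (replicate e w ++ W ++ replicate k w))
    ≡⟨ fillʳ-all v s _ ⟩
  justs (replicate s v ++ replicate e w ++ W ++ replicate k w) ∎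
  where
  reassoc : ((holes s ++ justs (replicate e w)) ++ justs W) ++ justs (replicate k w) ≡ holes s ++ justs (replicate e w ++ W ++ replicate k w)
  reassoc = begin
    ((holes s ++ justs (replicate e w)) ++ justs W) ++ justs (replicate k w)
      ≡⟨ trans (++-assoc (holes s ++ justs (replicate e w)) _ _) (++-assoc (holes s) _ _) ⟩
    holes s ++ justs (replicate e w) ++ justs W ++ justs (replicate k w)
      ≡⟨ cong (holes s ++_) (trans (cong (justs (replicate e w) ++_) (sym (map-++ just W _))) (sym (map-++ just (replicate e w) _))) ⟩
    holes s ++ justs (replicate e w ++ W ++ replicate k w) ∎

fromMaybe-justs : ∀ d xs → map (fromMaybe d) (justs xs) ≡ xs
fromMaybe-justs d []       = refl
fromMaybe-justs d (x ∷ xs) = cong (x ∷_) (fromMaybe-justs d xs)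

countE-++ : ∀ p q → countE (p ++ q) ≡ countE p + countE q
countE-++ []      q = refl
countE-++ (E ∷ p) q = cong suc (countE-++ p q)
countE-++ (N ∷ p) q = countE-++ p q

countN-++ : ∀ p q → countN (p ++ q) ≡ countN p + countN q
countN-++ []      q = refl
countN-++ (E ∷ p) q = countN-++ p q
countN-++ (N ∷ p) q = cong suc (countN-++ p q)

countE-Eⁿ : ∀ n → countE (replicate n E) ≡ n
countE-Eⁿ zero    = refl
countE-Eⁿ (suc n) = cong suc (countE-Eⁿ n)

countE-Nⁿ : ∀ n → countE (replicate n N) ≡ 0
countE-Nⁿ zero    = refl
countE-Nⁿ (suc n) = countE-Nⁿ n

countN-Eⁿ : ∀ n → countN (replicate n E) ≡ 0
countN-Eⁿ zero    = refl
countN-Eⁿ (suc n) = countN-Eⁿ n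

countN-Nⁿ : ∀ n → countN (replicate n N) ≡ n
countN-Nⁿ zero    = refl
countN-Nⁿ (suc n) = cong suc (countN-Nⁿ n)

ysFrom : ℕ → Path → List ℕ
ysFrom y []      = []
ysFrom y (E ∷ p) = y ∷ ysFrom y p
ysFrom y (N ∷ p) = suc y ∷ ysFrom (suc y) p

endY : ℕ → Path → ℕ
endY y []      = y
endY y (E ∷ p) = endY y p
endY y (N ∷ p) = endY (suc y) p

ys≡0∷ysFrom : ∀ p → ys p ≡ 0 ∷ ysFrom 0 p
ys≡0∷ysFrom p = cong (0 ∷_) (go 0 0 p)
  where
  go : ∀ x y p → map (λ { (_ , y) → y }) (pointsFrom x y p) ≡ ysFrom y p
  go x y []      = refl
  go x y (E ∷ p) = cong (y ∷_) (go (suc x) y p)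
  go x y (N ∷ p) = cong (suc y ∷_) (go x (suc y) p)

ysFrom-++ : ∀ y p q → ysFrom y (p ++ q) ≡ ysFrom y p ++ ysFrom (endY y p) q
ysFrom-++ y []      q = refl
ysFrom-++ y (E ∷ p) q = cong (y ∷_) (ysFrom-++ y p q)
ysFrom-++ y (N ∷ p) q = cong (suc y ∷_) (ysFrom-++ (suc y) p q)

ascending : ℕ → ℕ → List ℕ
ascending y zero    = []
ascending y (suc n) = suc y ∷ ascending (suc y) n

ysFrom-Eⁿ : ∀ y n → ysFrom y (replicate n E) ≡ replicate n y
ysFrom-Eⁿ y zero    = refl
ysFrom-Eⁿ y (suc n) = cong (y ∷_) (ysFrom-Eⁿ y n)

endY-Eⁿ : ∀ y n → endY y (replicate n E) ≡ y
endY-Eⁿ y zero    = refl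
endY-Eⁿ y (suc n) = endY-Eⁿ y n

ysFrom-Nⁿ : ∀ y n → ysFrom y (replicate n N) ≡ ascending y n
ysFrom-Nⁿ y zero    = refl
ysFrom-Nⁿ y (suc n) = cong (suc y ∷_) (ysFrom-Nⁿ (suc y) n)

endY-Nⁿ : ∀ y n → endY y (replicate n N) ≡ n + y
endY-Nⁿ y zero    = refl
endY-Nⁿ y (suc n) = trans (endY-Nⁿ (suc y) n) (+-suc n y)

length-ascending : ∀ y n → length (ascending y n) ≡ n
length-ascending y zero    = refl
length-ascending y (suc n) = cong suc (length-ascending (suc y) n)

ascending-+ : ∀ y m n → ascending y (m + suc n) ≡ ascending y m ++ suc (m + y) ∷ ascending (suc (m + y)) n
ascending-+ y zero    n = refl
ascending-+ y (suc m) n = cong (suc y ∷_) (trans (ascending-+ (suc y) m n)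
  (cong (λ z → ascending (suc y) m ++ suc z ∷ ascending (suc z) n) (+-suc m y)))

ascending-> : ∀ y n → All (y <_) (ascending y n)
ascending-> y zero    = []
ascending-> y (suc n) = ≤-refl ∷ All.map (<-trans (n<1+n y)) (ascending-> (suc y) n)

ascending-≤ : ∀ y n → All (_≤ n + y) (ascending y n)
ascending-≤ y zero    = []
ascending-≤ y (suc n) =
  s≤s (m≤n+m y n) ∷ All.map (λ le → ≤-trans le (≤-reflexive (+-suc n y))) (ascending-≤ (suc y) n)

countVal-++ : ∀ i xs zs → countVal i (xs ++ zs) ≡ countVal i xs + countVal i zs
countVal-++ i []       zs = refl
countVal-++ i (x ∷ xs) zs with x ≡ᵇ i
... | true  = cong suc (countVal-++ i xs zs)
... | false = countVal-++ i xs zs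

countVal-absent : ∀ i xs → All (_≢ i) xs → countVal i xs ≡ 0
countVal-absent i []       []         = refl
countVal-absent i (x ∷ xs) (x≢i ∷ hs) rewrite ≢⇒≡ᵇ≡false x≢i = countVal-absent i xs hs

countVal-replicate : ∀ i n → countVal i (replicate n i) ≡ n
countVal-replicate i zero    = refl
countVal-replicate i (suc n) rewrite ≡ᵇ-refl i = cong suc (countVal-replicate i n)

replicate-≢ : ∀ {i x : ℕ} n → x ≢ i → All (_≢ i) (replicate n x)
replicate-≢ zero    x≢i = []
replicate-≢ (suc n) x≢i = x≢i ∷ replicate-≢ n x≢i

countVal-ascending-≤ : ∀ i y n → i ≤ y → countVal i (ascending y n) ≡ 0
countVal-ascending-≤ i y n i≤y = countVal-absent i (ascending y n) (All.map (λ y<x → >⇒≢ (≤-<-trans i≤y y<x)) (ascending-> y n))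

countVal-ascending-> : ∀ i y n → n + y < i → countVal i (ascending y n) ≡ 0
countVal-ascending-> i y n lt = countVal-absent i (ascending y n) (All.map (λ x≤ x≡i → <-irrefl x≡i (≤-<-trans x≤ lt)) (ascending-≤ y n))

countVal-ascending-∈ : ∀ i y n → y < i → i ≤ n + y → countVal i (ascending y n) ≡ 1
countVal-ascending-∈ i y zero    y<i i≤y = ⊥-elim (<-irrefl refl (<-≤-trans y<i i≤y))
countVal-ascending-∈ i y (suc n) y<i i≤ with suc y ≟ i
... | yes refl rewrite ≡ᵇ-refl (suc y) = cong suc (countVal-ascending-≤ (suc y) (suc y) n ≤-refl)
... | no y+1≢i rewrite ≢⇒≡ᵇ≡false y+1≢i =
  countVal-ascending-∈ i (suc y) n (≤∧≢⇒< y<i y+1≢i) (≤-trans i≤ (≤-reflexive (sym (+-suc n y))))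

lastIdxFrom-++ : ∀ i j xs zs acc → lastIdxFrom i j (xs ++ zs) acc ≡ lastIdxFrom i (length xs + j) zs (lastIdxFrom i j xs acc)
lastIdxFrom-++ i j []       zs acc = refl
lastIdxFrom-++ i j (x ∷ xs) zs acc =
  trans (lastIdxFrom-++ i (suc j) xs zs acc′) (cong (λ j′ → lastIdxFrom i j′ zs (lastIdxFrom i (suc j) xs acc′)) (+-suc (length xs) j))
  where acc′ = if x ≡ᵇ i then j else acc

lastIdxFrom-absent : ∀ i j xs acc → All (_≢ i) xs → lastIdxFrom i j xs acc ≡ acc
lastIdxFrom-absent i j []       acc []         = refl
lastIdxFrom-absent i j (x ∷ xs) acc (x≢i ∷ hs) rewrite ≢⇒≡ᵇ≡false x≢i = lastIdxFrom-absent i (suc j) xs acc hs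

fixedPos-last : ∀ ρ i pre post → ys ρ ≡ pre ++ i ∷ post → All (_≢ i) post → fixedPos ρ i ≡ length pre
fixedPos-last ρ i pre post ys≡ post≢i = begin
  lastIdxFrom i 0 (ys ρ) 0                     ≡⟨ cong (λ zs → lastIdxFrom i 0 zs 0) ys≡ ⟩
  lastIdxFrom i 0 (pre ++ i ∷ post) 0          ≡⟨ lastIdxFrom-++ i 0 pre (i ∷ post) 0 ⟩
  lastIdxFrom i j post (if i ≡ᵇ i then length pre + 0 else lastIdxFrom i 0 pre 0)
      ≡⟨ cong (λ b → lastIdxFrom i j post (if b then length pre + 0 else lastIdxFrom i 0 pre 0)) (≡ᵇ-refl i) ⟩
  lastIdxFrom i j post (length pre + 0)        ≡⟨ lastIdxFrom-absent i j post _ post≢i ⟩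
  length pre + 0                               ≡⟨ +-identityʳ _ ⟩
  length pre                                   ∎
  where j = suc (length pre + 0)

ν̂ : ℕ → ℕ → ℕ → Path
ν̂ C A k = replicate (suc C) E ++ replicate A N ++ replicate k E ++ N ∷ []

nuHat≡ν̂ : ∀ C A k → nuHat (suc A) (suc (C + k)) k ≡ ν̂ C A k
nuHat≡ν̂ C A k = cong (λ c → replicate c E ++ replicate A N ++ replicate k E ++ N ∷ []) (m+n∸n≡m (suc C) k)

module _ (C A k : ℕ) where

  ys-ν̂ : ys (ν̂ C A k) ≡ replicate (suc (suc C)) 0 ++ ascending 0 A ++ replicate k A ++ suc A ∷ []
  ys-ν̂ = begin
    ys (ν̂ C A k)
      ≡⟨ ys≡0∷ysFrom (ν̂ C A k) ⟩
    0 ∷ ysFrom 0 (replicate (suc C) E ++ replicate A N ++ replicate k E ++ N ∷ [])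
      ≡⟨ cong (0 ∷_) (ysFrom-++ 0 (replicate (suc C) E) _) ⟩
    0 ∷ ysFrom 0 (replicate (suc C) E) ++ ysFrom (endY 0 (replicate (suc C) E)) (replicate A N ++ replicate k E ++ N ∷ [])
      ≡⟨ cong₂ (λ as y → 0 ∷ as ++ ysFrom y (replicate A N ++ replicate k E ++ N ∷ [])) (ysFrom-Eⁿ 0 (suc C)) (endY-Eⁿ 0 (suc C)) ⟩
    0 ∷ replicate (suc C) 0 ++ ysFrom 0 (replicate A N ++ replicate k E ++ N ∷ [])
      ≡⟨ cong (λ as → 0 ∷ replicate (suc C) 0 ++ as) (ysFrom-++ 0 (replicate A N) _) ⟩
    0 ∷ replicate (suc C) 0 ++ ysFrom 0 (replicate A N) ++ ysFrom (endY 0 (replicate A N)) (replicate k E ++ N ∷ [])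
      ≡⟨ cong₂ (λ as y → 0 ∷ replicate (suc C) 0 ++ as ++ ysFrom y (replicate k E ++ N ∷ [])) (ysFrom-Nⁿ 0 A) (trans (endY-Nⁿ 0 A) (+-identityʳ A)) ⟩
    0 ∷ replicate (suc C) 0 ++ ascending 0 A ++ ysFrom A (replicate k E ++ N ∷ [])
      ≡⟨ cong (λ as → 0 ∷ replicate (suc C) 0 ++ ascending 0 A ++ as)
           (trans (ysFrom-++ A (replicate k E) (N ∷ [])) (cong₂ (λ as y → as ++ ysFrom y (N ∷ [])) (ysFrom-Eⁿ A k) (endY-Eⁿ A k))) ⟩
    0 ∷ replicate (suc C) 0 ++ ascending 0 A ++ replicate k A ++ suc A ∷ [] ∎

  countN-ν̂ : countN (ν̂ C A k) ≡ suc A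
  countN-ν̂ = begin
    countN (ν̂ C A k)
      ≡⟨ countN-++ (replicate (suc C) E) _ ⟩
    countN (replicate (suc C) E) + countN (replicate A N ++ replicate k E ++ N ∷ [])
      ≡⟨ cong₂ _+_ (countN-Eⁿ (suc C)) (countN-++ (replicate A N) _) ⟩
    countN (replicate A N) + countN (replicate k E ++ N ∷ [])
      ≡⟨ cong₂ _+_ (countN-Nⁿ A) (trans (countN-++ (replicate k E) (N ∷ [])) (cong (_+ 1) (countN-Eⁿ k))) ⟩
    A + 1
      ≡⟨ +-comm A 1 ⟩
    suc A ∎

  suc-length-ν̂ : suc (length (ν̂ C A k)) ≡ suc C + (A + (k + 2))
  suc-length-ν̂ = begin
    suc (length (ν̂ C A k))
      ≡⟨ cong suc (length-++ (replicate (suc C) E)) ⟩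
    suc (length (replicate (suc C) E) + length (replicate A N ++ replicate k E ++ N ∷ []))
      ≡⟨ cong₂ (λ a b → suc (a + b)) (length-replicate (suc C)) (length-++ (replicate A N)) ⟩
    suc (suc C + (length (replicate A N) + length (replicate k E ++ N ∷ [])))
      ≡⟨ cong₂ (λ a b → suc (suc C + (a + b))) (length-replicate A) (trans (length-++ (replicate k E)) (cong (_+ 1) (length-replicate k))) ⟩
    suc (suc C + (A + (k + 1)))
      ≡⟨ sym (+-suc (suc C) _) ⟩
    suc C + suc (A + (k + 1))
      ≡⟨ cong (suc C +_) (sym (trans (cong (A +_) (+-suc k 1)) (+-suc A (k + 1)))) ⟩
    suc C + (A + (k + 2)) ∎

fixedPos-ν̂-< : ∀ C A k i → i < A → fixedPos (ν̂ C A k) i ≡ suc C + i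
fixedPos-ν̂-< C (suc A) k zero _ = trans
  (fixedPos-last (ν̂ C (suc A) k) 0 (replicate (suc C) 0) post
    (trans (ys-ν̂ C (suc A) k) (sym (replicate-++-∷ (suc C) 0 post)))
    (++⁺ (All.map >⇒≢ (ascending-> 0 (suc A))) (++⁺ (replicate-≢ k λ ()) ((λ ()) ∷ []))))
  (trans (length-replicate (suc C)) (sym (+-identityʳ (suc C))))
  where post = ascending 0 (suc A) ++ replicate k (suc A) ++ suc (suc A) ∷ []
fixedPos-ν̂-< C A k (suc i) i<A with m≤n⇒∃[o]m+o≡n i<A
... | o , refl = trans
  (fixedPos-last (ν̂ C A k) (suc i) pre post ys≡ post≢)
  (trans (length-++ (replicate (suc (suc C)) 0)) (trans (cong₂ _+_ (length-replicate (suc (suc C))) (length-ascending 0 i)) (sym (+-suc (suc C) i))))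
  where
  pre = replicate (suc (suc C)) 0 ++ ascending 0 i
  post = ascending (suc i) (suc o) ++ replicate k A ++ suc A ∷ []
  A≡ : A ≡ i + suc (suc o)
  A≡ = sym (trans (+-suc i (suc o)) (cong suc (+-suc i o)))
  ascending-A : ascending 0 A ≡ ascending 0 i ++ suc i ∷ ascending (suc i) (suc o)
  ascending-A = trans (cong (ascending 0) A≡)
    (trans (ascending-+ 0 i (suc o)) (cong (λ j → ascending 0 i ++ suc j ∷ ascending (suc j) (suc o)) (+-identityʳ i)))
  ys≡ : ys (ν̂ C A k) ≡ pre ++ suc i ∷ post
  ys≡ = begin
    ys (ν̂ C A k)
      ≡⟨ ys-ν̂ C A k ⟩
    replicate (suc (suc C)) 0 ++ ascending 0 A ++ replicate k A ++ suc A ∷ []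
      ≡⟨ cong (λ as → replicate (suc (suc C)) 0 ++ as ++ replicate k A ++ suc A ∷ []) ascending-A ⟩
    replicate (suc (suc C)) 0 ++ (ascending 0 i ++ suc i ∷ ascending (suc i) (suc o)) ++ replicate k A ++ suc A ∷ []
      ≡⟨ cong (replicate (suc (suc C)) 0 ++_) (++-assoc (ascending 0 i) _ _) ⟩
    replicate (suc (suc C)) 0 ++ ascending 0 i ++ suc i ∷ post
      ≡⟨ sym (++-assoc (replicate (suc (suc C)) 0) (ascending 0 i) _) ⟩
    pre ++ suc i ∷ post ∎
  post≢ : All (_≢ suc i) post
  post≢ = ++⁺ (All.map >⇒≢ (ascending-> (suc i) (suc o)))
    (++⁺ (replicate-≢ k (>⇒≢ i<A)) (>⇒≢ (m<n⇒m<1+n i<A) ∷ []))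

fixedPos-ν̂-top : ∀ C A k → fixedPos (ν̂ C A k) (suc A) ≡ suc (suc C + A + k)
fixedPos-ν̂-top C A k = trans
  (fixedPos-last (ν̂ C A k) (suc A) pre [] (trans (ys-ν̂ C A k) reassoc) [])
  (trans (length-++ (replicate (suc (suc C)) 0))
    (trans (cong₂ _+_ (length-replicate (suc (suc C))) (trans (length-++ (ascending 0 A)) (cong₂ _+_ (length-ascending 0 A) (length-replicate k))))
      (cong suc (sym (+-assoc (suc C) A k)))))
  where
  pre = replicate (suc (suc C)) 0 ++ ascending 0 A ++ replicate k A
  reassoc : replicate (suc (suc C)) 0 ++ ascending 0 A ++ replicate k A ++ suc A ∷ [] ≡ pre ++ suc A ∷ []
  reassoc = trans (cong (replicate (suc (suc C)) 0 ++_) (sym (++-assoc (ascending 0 A) _ _))) (sym (++-assoc (replicate (suc (suc C)) 0) _ _))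

upTo-suc : ∀ n → upTo (suc n) ≡ 0 ∷ ascending 0 n
upTo-suc zero    = refl
upTo-suc (suc n) = begin
  upTo (suc (suc n))                ≡⟨ sym (upTo-∷ʳ (suc n)) ⟩
  upTo (suc n) ∷ʳ suc n             ≡⟨ cong (_∷ʳ suc n) (upTo-suc n) ⟩
  0 ∷ ascending 0 n ++ suc n ∷ []   ≡⟨ cong (0 ∷_) (sym ascending-suc) ⟩
  0 ∷ ascending 0 (suc n)           ∎
  where
  ascending-suc : ascending 0 (suc n) ≡ ascending 0 n ++ suc n ∷ []
  ascending-suc = trans (cong (ascending 0) (sym (+-comm n 1)))
    (trans (ascending-+ 0 n 0) (cong (λ j → ascending 0 n ++ suc j ∷ []) (+-identityʳ n)))

fixedPos-ν̂-A : ∀ C A k → fixedPos (ν̂ C A k) A ≡ suc C + A + k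
fixedPos-ν̂-A C A k = trans
  (fixedPos-last (ν̂ C A k) A pre (suc A ∷ []) ys≡ (>⇒≢ (n<1+n A) ∷ []))
  (trans (length-++ (replicate (suc C) 0))
    (trans (cong₂ _+_ (length-replicate (suc C)) (trans (length-++ (upTo A)) (cong₂ _+_ (length-upTo A) (length-replicate k))))
      (sym (+-assoc (suc C) A k))))
  where
  pre = replicate (suc C) 0 ++ upTo A ++ replicate k A
  ys≡ : ys (ν̂ C A k) ≡ pre ++ A ∷ suc A ∷ []
  ys≡ = begin
    ys (ν̂ C A k)
      ≡⟨ trans (ys-ν̂ C A k) (sym (replicate-++-∷ (suc C) 0 _)) ⟩
    replicate (suc C) 0 ++ (0 ∷ ascending 0 A) ++ replicate k A ++ suc A ∷ []
      ≡⟨ cong (λ as → replicate (suc C) 0 ++ as ++ replicate k A ++ suc A ∷ []) (trans (sym (upTo-suc A)) (sym (upTo-∷ʳ A))) ⟩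
    replicate (suc C) 0 ++ (upTo A ++ A ∷ []) ++ replicate k A ++ suc A ∷ []
      ≡⟨ cong (replicate (suc C) 0 ++_) (++-assoc (upTo A) (A ∷ []) _) ⟩
    replicate (suc C) 0 ++ upTo A ++ A ∷ replicate k A ++ suc A ∷ []
      ≡⟨ cong (λ as → replicate (suc C) 0 ++ upTo A ++ as) (sym (replicate-++-∷ k A (suc A ∷ []))) ⟩
    replicate (suc C) 0 ++ upTo A ++ replicate k A ++ A ∷ suc A ∷ []
      ≡⟨ cong (replicate (suc C) 0 ++_) (sym (++-assoc (upTo A) _ _)) ⟩
    replicate (suc C) 0 ++ (upTo A ++ replicate k A) ++ A ∷ suc A ∷ []
      ≡⟨ sym (++-assoc (replicate (suc C) 0) _ _) ⟩
    pre ++ A ∷ suc A ∷ [] ∎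

module _ (C A k : ℕ) where

  private
    setFixed : List (Maybe ℕ) → ℕ → List (Maybe ℕ)
    setFixed b i = setAt (fixedPos (ν̂ C A k) i) (just i) b

    T : List (Maybe ℕ)
    T = holes k ++ nothing ∷ nothing ∷ []

    setFixed-below : ∀ m n → m + n ≡ A →
      foldl setFixed (holes (suc C) ++ holes A ++ T) (upTo m) ≡ holes (suc C) ++ justs (upTo m) ++ holes n ++ T
    setFixed-below zero    n refl = refl
    setFixed-below (suc m) n m+n≡A = begin
      foldl setFixed V (upTo (suc m))
        ≡⟨ cong (foldl setFixed V) (sym (upTo-∷ʳ m)) ⟩
      foldl setFixed V (upTo m ∷ʳ m)
        ≡⟨ foldl-∷ʳ setFixed V m (upTo m) ⟩
      setFixed (foldl setFixed V (upTo m)) m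
        ≡⟨ cong (λ b → setFixed b m) (setFixed-below m (suc n) (trans (+-suc m n) m+n≡A)) ⟩
      setAt (fixedPos (ν̂ C A k) m) (just m) (holes (suc C) ++ justs (upTo m) ++ nothing ∷ holes n ++ T)
        ≡⟨ cong₂ (λ j b → setAt j (just m) b) (trans (fixedPos-ν̂-< C A k m m<A) (sym length-P)) (sym (++-assoc (holes (suc C)) _ _)) ⟩
      setAt (length P) (just m) (P ++ nothing ∷ holes n ++ T)
        ≡⟨ setAt-length P (just m) nothing _ ⟩
      P ++ just m ∷ holes n ++ T
        ≡⟨ ++-assoc (holes (suc C)) _ _ ⟩
      holes (suc C) ++ justs (upTo m) ++ just m ∷ holes n ++ T
        ≡⟨ cong (holes (suc C) ++_) (sym (++-assoc (justs (upTo m)) (just m ∷ []) _)) ⟩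
      holes (suc C) ++ (justs (upTo m) ++ just m ∷ []) ++ holes n ++ T
        ≡⟨ cong (λ js → holes (suc C) ++ js ++ holes n ++ T) (trans (sym (map-++ just (upTo m) (m ∷ []))) (cong justs (upTo-∷ʳ m))) ⟩
      holes (suc C) ++ justs (upTo (suc m)) ++ holes n ++ T ∎
      where
      V = holes (suc C) ++ holes A ++ T
      P = holes (suc C) ++ justs (upTo m)
      m<A : m < A
      m<A = subst (m <_) m+n≡A (m≤m+n (suc m) n)
      length-P : length P ≡ suc C + m
      length-P = trans (length-++ (holes (suc C))) (cong₂ _+_ (length-replicate (suc C)) (trans (length-map just (upTo m)) (length-upTo m)))

  initBracket-ν̂ : initBracket (ν̂ C A k) ≡ holes (suc C) ++ justs (upTo A) ++ holes k ++ just A ∷ just (suc A) ∷ []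
  initBracket-ν̂ = begin
    initBracket (ν̂ C A k)
      ≡⟨ cong₂ (λ l n → foldl setFixed (holes l) (upTo (suc n))) (suc-length-ν̂ C A k) (countN-ν̂ C A k) ⟩
    foldl setFixed (holes (suc C + (A + (k + 2)))) (upTo (suc (suc A)))
      ≡⟨ cong₂ (foldl setFixed) holes-split (sym (trans (cong (_∷ʳ suc A) (upTo-∷ʳ A)) (upTo-∷ʳ (suc A)))) ⟩
    foldl setFixed V ((upTo A ∷ʳ A) ∷ʳ suc A)
      ≡⟨ trans (foldl-∷ʳ setFixed V (suc A) (upTo A ∷ʳ A)) (cong (λ b → setFixed b (suc A)) (foldl-∷ʳ setFixed V A (upTo A))) ⟩
    setFixed (setFixed (foldl setFixed V (upTo A)) A) (suc A)
      ≡⟨ cong (λ b → setFixed (setFixed b A) (suc A)) (trans (setFixed-below A 0 (+-identityʳ A)) reassoc) ⟩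
    setFixed (setAt (fixedPos (ν̂ C A k) A) (just A) (P ++ nothing ∷ nothing ∷ [])) (suc A)
      ≡⟨ cong (λ j → setFixed (setAt j (just A) (P ++ nothing ∷ nothing ∷ [])) (suc A)) (trans (fixedPos-ν̂-A C A k) (sym length-P)) ⟩
    setFixed (setAt (length P) (just A) (P ++ nothing ∷ nothing ∷ [])) (suc A)
      ≡⟨ cong (λ b → setFixed b (suc A)) (setAt-length P (just A) nothing _) ⟩
    setAt (fixedPos (ν̂ C A k) (suc A)) (just (suc A)) (P ++ just A ∷ nothing ∷ [])
      ≡⟨ cong₂ (λ j b → setAt j (just (suc A)) b) (trans (fixedPos-ν̂-top C A k) (sym length-P′)) (sym (++-assoc P (just A ∷ []) _)) ⟩
    setAt (length (P ++ just A ∷ [])) (just (suc A)) ((P ++ just A ∷ []) ++ nothing ∷ [])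
      ≡⟨ setAt-length (P ++ just A ∷ []) (just (suc A)) nothing [] ⟩
    (P ++ just A ∷ []) ++ just (suc A) ∷ []
      ≡⟨ trans (++-assoc P _ _) (trans (++-assoc (holes (suc C)) _ _) (cong (holes (suc C) ++_) (++-assoc (justs (upTo A)) _ _))) ⟩
    holes (suc C) ++ justs (upTo A) ++ holes k ++ just A ∷ just (suc A) ∷ [] ∎
    where
    V = holes (suc C) ++ holes A ++ T
    P = holes (suc C) ++ justs (upTo A) ++ holes k
    holes-split : holes (suc C + (A + (k + 2))) ≡ V
    holes-split = trans (replicate-+ (suc C) _ nothing) (cong (holes (suc C) ++_) (trans (replicate-+ A _ nothing) (cong (holes A ++_) (replicate-+ k 2 nothing))))
    reassoc : holes (suc C) ++ justs (upTo A) ++ holes 0 ++ T ≡ P ++ nothing ∷ nothing ∷ []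
    reassoc = trans (cong (holes (suc C) ++_) (sym (++-assoc (justs (upTo A)) _ _))) (sym (++-assoc (holes (suc C)) _ _))
    length-P : length P ≡ suc C + A + k
    length-P = trans (length-++ (holes (suc C)))
      (trans (cong₂ _+_ (length-replicate (suc C)) (trans (length-++ (justs (upTo A))) (cong₂ _+_ (trans (length-map just (upTo A)) (length-upTo A)) (length-replicate k))))
        (sym (+-assoc (suc C) A k)))
    length-P′ : length (P ++ just A ∷ []) ≡ suc (suc C + A + k)
    length-P′ = trans (length-++ P) (trans (cong (_+ 1) length-P) (+-comm _ 1))

fixedPos-ν̂-range : ∀ C A k i → i < suc (suc A) →
  (suc C ≤ fixedPos (ν̂ C A k) i × fixedPos (ν̂ C A k) i < suc C + A) ⊎ suc C + A + k ≤ fixedPos (ν̂ C A k) i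
fixedPos-ν̂-range C A k i i<A+2 with <-cmp i A
... | tri< i<A _ _ rewrite fixedPos-ν̂-< C A k i i<A = inj₁ (m≤m+n (suc C) i , +-monoʳ-< (suc C) i<A)
... | tri≈ _ refl _ = inj₂ (≤-reflexive (sym (fixedPos-ν̂-A C A k)))
... | tri> _ _ A<i rewrite ≤-antisym (s≤s⁻¹ i<A+2) A<i = inj₂ (≤-trans (n≤1+n _) (≤-reflexive (sym (fixedPos-ν̂-top C A k))))

isFixed-ν̂-free : ∀ C A k j → j < suc C ⊎ (suc C + A ≤ j × j < suc C + A + k) → isFixed (ν̂ C A k) j ≡ false
isFixed-ν̂-free C A k j j-free =
  trans (cong (λ n → any (λ i → fixedPos (ν̂ C A k) i ≡ᵇ j) (upTo (suc n))) (countN-ν̂ C A k))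
        (any-upTo-false _ (suc (suc A)) (λ i i<A+2 → ≢⇒≡ᵇ≡false (not-j (fixedPos-ν̂-range C A k i i<A+2) j-free)))
  where
  not-j : ∀ {f} → (suc C ≤ f × f < suc C + A) ⊎ suc C + A + k ≤ f → j < suc C ⊎ (suc C + A ≤ j × j < suc C + A + k) → f ≢ j
  not-j (inj₁ (C<f , _)) (inj₁ j≤C)       refl = <-irrefl refl (<-≤-trans j≤C C<f)
  not-j (inj₁ (_ , f<))  (inj₂ (≤j , _))  refl = <-irrefl refl (<-≤-trans f< ≤j)
  not-j (inj₂ ≤f)        (inj₁ j≤C)       refl = <-irrefl refl (<-≤-trans j≤C (≤-trans (≤-trans (m≤m+n (suc C) A) (m≤m+n (suc C + A) k)) ≤f))
  not-j (inj₂ ≤f)        (inj₂ (_ , j<))  refl = <-irrefl refl (<-≤-trans j< ≤f)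

isFixed-ν̂-top : ∀ C A k → isFixed (ν̂ C A k) (suc (suc C + A + k)) ≡ true
isFixed-ν̂-top C A k =
  trans (cong (λ n → any (λ i → fixedPos (ν̂ C A k) i ≡ᵇ j) (upTo (suc n))) (countN-ν̂ C A k))
        (any-upTo-last (λ i → fixedPos (ν̂ C A k) i ≡ᵇ j) (suc A) (trans (cong (_≡ᵇ j) (fixedPos-ν̂-top C A k)) (≡ᵇ-refl j)))
  where j = suc (suc C + A + k)

module CountT (ρ : Path) (a sp : ℕ) where

  countT-++ : ∀ j xs zs → countT ρ a sp j (xs ++ zs) ≡ countT ρ a sp j xs + countT ρ a sp (length xs + j) zs
  countT-++ j []       zs = refl
  countT-++ j (x ∷ xs) zs with not (isFixed ρ j) ∧ not (j ≡ᵇ sp) ∧ (x ≡ᵇ a)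
  ... | true  = cong suc (trans (countT-++ (suc j) xs zs) (cong (λ i → countT ρ a sp (suc j) xs + countT ρ a sp i zs) (+-suc (length xs) j)))
  ... | false = trans (countT-++ (suc j) xs zs) (cong (λ i → countT ρ a sp (suc j) xs + countT ρ a sp i zs) (+-suc (length xs) j))

  countT-absent : ∀ j xs → All (_≢ a) xs → countT ρ a sp j xs ≡ 0
  countT-absent j []       []         = refl
  countT-absent j (x ∷ xs) (x≢a ∷ hs) rewrite ≢⇒≡ᵇ≡false x≢a
    | ∧-zeroʳ (not (j ≡ᵇ sp)) | ∧-zeroʳ (not (isFixed ρ j)) = countT-absent (suc j) xs hs

  countT-free : ∀ j xs → (∀ i → i < length xs → isFixed ρ (i + j) ≡ false × i + j ≢ sp) → countT ρ a sp j xs ≡ countVal a xs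
  countT-free j []       free = refl
  countT-free j (x ∷ xs) free rewrite proj₁ (free 0 (s≤s z≤n)) | ≢⇒≡ᵇ≡false (proj₂ (free 0 (s≤s z≤n))) with x ≡ᵇ a
  ... | true  = cong suc (countT-free (suc j) xs free′)
    where free′ = λ i i<n → subst (λ j′ → isFixed ρ j′ ≡ false × j′ ≢ sp) (sym (+-suc i j)) (free (suc i) (s≤s i<n))
  ... | false = countT-free (suc j) xs λ i i<n → subst (λ j′ → isFixed ρ j′ ≡ false × j′ ≢ sp) (sym (+-suc i j)) (free (suc i) (s≤s i<n))

  countT-fixed : ∀ j x → isFixed ρ j ≡ true → countT ρ a sp j (x ∷ []) ≡ 0
  countT-fixed j x fixed rewrite fixed = refl

  countT-sp : ∀ x → countT ρ a sp sp (x ∷ []) ≡ 0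
  countT-sp x rewrite ≡ᵇ-refl sp | ∧-zeroʳ (not (isFixed ρ sp)) = refl

nth-length-++ : ∀ xs (x : ℕ) zs → nth (length xs) (xs ++ x ∷ zs) ≡ x
nth-length-++ []       x zs = refl
nth-length-++ (_ ∷ xs) x zs = nth-length-++ xs x zs

upTo-< : ∀ n → All (_< n) (upTo n)
upTo-< zero    = []
upTo-< (suc n) = subst (All (_< suc n)) (upTo-∷ʳ n) (++⁺ (All.map m<n⇒m<1+n (upTo-< n)) (≤-refl ∷ []))

private
  position-of-A : ∀ C A k → k + (A + suc C) ≡ suc C + A + k
  position-of-A = solve-∀

fixedPos-ν̂-zero : ∀ C A k → (A ≡ 0 → k ≡ 0) → fixedPos (ν̂ C A k) 0 ≡ suc C
fixedPos-ν̂-zero C zero    k A≡0⇒k≡0 = trans (fixedPos-ν̂-A C 0 k) (trans (cong (suc C + 0 +_) (A≡0⇒k≡0 refl)) (trans (+-identityʳ _) (+-identityʳ _)))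
fixedPos-ν̂-zero C (suc A) k _       = trans (fixedPos-ν̂-< C (suc A) k 0 (s≤s z≤n)) (+-identityʳ (suc C))

module _ (C A k : ℕ) where

  private
    ct : ℕ → List ℕ → ℕ
    ct = countT (ν̂ C A k) (suc A) C
  open CountT (ν̂ C A k) (suc A) C

  countT-ν̂-bracket : ∀ P x K → length P ≡ C → length K ≡ k →
    ct 0 (P ++ x ∷ upTo A ++ K ++ A ∷ suc A ∷ []) ≡ countVal (suc A) P + countVal (suc A) K
  countT-ν̂-bracket P x K ∣P∣≡C ∣K∣≡k = begin
    ct 0 (P ++ x ∷ upTo A ++ K ++ A ∷ suc A ∷ [])
      ≡⟨ countT-++ 0 P _ ⟩
    ct 0 P + ct (length P + 0) ((x ∷ []) ++ upTo A ++ K ++ A ∷ suc A ∷ [])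
      ≡⟨ cong₂ _+_ (countT-free 0 P freeP) (cong (λ j → ct j ((x ∷ []) ++ upTo A ++ K ++ A ∷ suc A ∷ [])) (trans (+-identityʳ _) ∣P∣≡C)) ⟩
    countVal (suc A) P + ct C ((x ∷ []) ++ upTo A ++ K ++ A ∷ suc A ∷ [])
      ≡⟨ cong (countVal (suc A) P +_) (countT-++ C (x ∷ []) (upTo A ++ K ++ A ∷ suc A ∷ [])) ⟩
    countVal (suc A) P + (ct C (x ∷ []) + ct (suc C) (upTo A ++ K ++ A ∷ suc A ∷ []))
      ≡⟨ cong (λ n → countVal (suc A) P + (n + ct (suc C) (upTo A ++ K ++ A ∷ suc A ∷ []))) (countT-sp x) ⟩
    countVal (suc A) P + ct (suc C) (upTo A ++ K ++ A ∷ suc A ∷ [])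
      ≡⟨ cong (countVal (suc A) P +_) (countT-++ (suc C) (upTo A) (K ++ A ∷ suc A ∷ [])) ⟩
    countVal (suc A) P + (ct (suc C) (upTo A) + ct (length (upTo A) + suc C) (K ++ A ∷ suc A ∷ []))
      ≡⟨ cong₂ (λ n j → countVal (suc A) P + (n + ct j (K ++ A ∷ suc A ∷ [])))
           (countT-absent (suc C) (upTo A) (All.map (λ i<A → <⇒≢ (m<n⇒m<1+n i<A)) (upTo-< A))) (cong (_+ suc C) (length-upTo A)) ⟩
    countVal (suc A) P + ct (A + suc C) (K ++ A ∷ suc A ∷ [])
      ≡⟨ cong (countVal (suc A) P +_) (countT-++ (A + suc C) K (A ∷ suc A ∷ [])) ⟩
    countVal (suc A) P + (ct (A + suc C) K + ct (length K + (A + suc C)) ((A ∷ []) ++ suc A ∷ []))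
      ≡⟨ cong₂ (λ m n → countVal (suc A) P + (m + n)) (countT-free (A + suc C) K freeK) tail≡0 ⟩
    countVal (suc A) P + (countVal (suc A) K + 0)
      ≡⟨ cong (countVal (suc A) P +_) (+-identityʳ _) ⟩
    countVal (suc A) P + countVal (suc A) K ∎
    where
    freeP : ∀ i → i < length P → isFixed (ν̂ C A k) (i + 0) ≡ false × i + 0 ≢ C
    freeP i i<∣P∣ = isFixed-ν̂-free C A k (i + 0) (inj₁ (s≤s (≤-trans (≤-reflexive (+-identityʳ i)) (<⇒≤ i<C))))
                  , λ i+0≡C → <-irrefl (trans (sym (+-identityʳ i)) i+0≡C) i<C
      where i<C = subst (i <_) ∣P∣≡C i<∣P∣
    freeK : ∀ i → i < length K → isFixed (ν̂ C A k) (i + (A + suc C)) ≡ false × i + (A + suc C) ≢ C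
    freeK i i<∣K∣ = isFixed-ν̂-free C A k _ (inj₂ (lower , upper)) , λ eq → <-irrefl (sym eq) C<
      where
      lower = ≤-trans (≤-reflexive (+-comm (suc C) A)) (m≤n+m (A + suc C) i)
      upper = subst₂ _<_ (+-comm (A + suc C) i) (cong (_+ k) (+-comm A (suc C))) (+-monoʳ-< (A + suc C) (subst (i <_) ∣K∣≡k i<∣K∣))
      C< = ≤-trans (m≤n+m (suc C) (i + A)) (≤-reflexive (+-assoc i A (suc C)))
    tail≡0 : ct (length K + (A + suc C)) ((A ∷ []) ++ suc A ∷ []) ≡ 0
    tail≡0 = begin
      ct (length K + (A + suc C)) ((A ∷ []) ++ suc A ∷ [])
        ≡⟨ cong (λ j → ct j ((A ∷ []) ++ suc A ∷ [])) (trans (cong (_+ (A + suc C)) ∣K∣≡k) (position-of-A C A k)) ⟩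
      ct (suc C + A + k) ((A ∷ []) ++ suc A ∷ [])
        ≡⟨ countT-++ (suc C + A + k) (A ∷ []) (suc A ∷ []) ⟩
      ct (suc C + A + k) (A ∷ []) + ct (suc (suc C + A + k)) (suc A ∷ [])
        ≡⟨ cong₂ _+_ (countT-absent _ (A ∷ []) (<⇒≢ (n<1+n A) ∷ [])) (countT-fixed _ (suc A) (isFixed-ν̂-top C A k)) ⟩
      0 ∎

simp-from-bracket : ∀ C A k → (A ≡ 0 → k ≡ 0) → ∀ μ P x K → length P ≡ C → length K ≡ k →
  bracket (ν̂ C A k) μ ≡ P ++ x ∷ upTo A ++ K ++ A ∷ suc A ∷ [] →
  simpS (suc A) (suc (C + k)) k μ ≡ x × simpT (suc A) (suc (C + k)) k μ ≡ countVal (suc A) P + countVal (suc A) K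
simp-from-bracket C A k A≡0⇒k≡0 μ P x K ∣P∣≡C ∣K∣≡k bracket≡ rewrite nuHat≡ν̂ C A k | fixedPos-ν̂-zero C A k A≡0⇒k≡0 | bracket≡ =
  subst (λ j → nth j (P ++ x ∷ _) ≡ x) ∣P∣≡C (nth-length-++ P x _) , countT-ν̂-bracket C A k P x K ∣P∣≡C ∣K∣≡k

module BracketSteps (ρ μ : Path) where

  fillStep : List (Maybe ℕ) → ℕ → List (Maybe ℕ)
  fillStep b i = fillLeft i (countVal i (ys μ) ∸ 1) (fixedPos ρ i) b

  fillStep-≤1 : ∀ V i → countVal i (ys μ) ≤ 1 → fillStep V i ≡ V
  fillStep-≤1 V i ≤1 = trans (cong (λ n → fillLeft i n (fixedPos ρ i) V) (m≤n⇒m∸n≡0 ≤1)) (fillLeft-zero i (fixedPos ρ i) V)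

  foldl-upTo-suc : ∀ V n → foldl fillStep V (upTo (suc n)) ≡ fillStep (foldl fillStep V (upTo n)) n
  foldl-upTo-suc V n = trans (cong (foldl fillStep V) (sym (upTo-∷ʳ n))) (foldl-∷ʳ fillStep V n (upTo n))

  foldl-skip : ∀ V n → (∀ i → i < n → countVal i (ys μ) ≤ 1) → foldl fillStep V (upTo n) ≡ V
  foldl-skip V zero    ≤1 = refl
  foldl-skip V (suc n) ≤1 = begin
    foldl fillStep V (upTo (suc n))          ≡⟨ foldl-upTo-suc V n ⟩
    fillStep (foldl fillStep V (upTo n)) n   ≡⟨ cong (λ b → fillStep b n) (foldl-skip V n (λ i i<n → ≤1 i (m<n⇒m<1+n i<n))) ⟩
    fillStep V n                             ≡⟨ fillStep-≤1 V n (≤1 n ≤-refl) ⟩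
    V                                        ∎

  foldl-single : ∀ V n p → p < n → (∀ i → i < n → i ≢ p → countVal i (ys μ) ≤ 1) → foldl fillStep V (upTo n) ≡ fillStep V p
  foldl-single V (suc n) p p<n+1 ≤1 with p ≟ n
  ... | yes refl = trans (foldl-upTo-suc V n)
                     (cong (λ b → fillStep b p) (foldl-skip V n (λ i i<n → ≤1 i (m<n⇒m<1+n i<n) (<⇒≢ i<n))))
  ... | no p≢n = begin
    foldl fillStep V (upTo (suc n))          ≡⟨ foldl-upTo-suc V n ⟩
    fillStep (foldl fillStep V (upTo n)) n
      ≡⟨ cong (λ b → fillStep b n) (foldl-single V n p (≤∧≢⇒< (s≤s⁻¹ p<n+1) p≢n) (λ i i<n → ≤1 i (m<n⇒m<1+n i<n))) ⟩
    fillStep (fillStep V p) n                ≡⟨ fillStep-≤1 (fillStep V p) n (≤1 n ≤-refl (p≢n ∘ sym)) ⟩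
    fillStep V p                             ∎

  bracket-unfold : ∀ A → countN ρ ≡ suc A →
    bracket ρ μ ≡ map (fromMaybe 0) (fillStep (fillStep (foldl fillStep (initBracket ρ) (upTo A)) A) (suc A))
  bracket-unfold A countN≡ = begin
    bracket ρ μ
      ≡⟨ cong (λ n → map (fromMaybe 0) (foldl fillStep (initBracket ρ) (upTo (suc n)))) countN≡ ⟩
    map (fromMaybe 0) (foldl fillStep (initBracket ρ) (upTo (suc (suc A))))
      ≡⟨ cong (map (fromMaybe 0)) (trans (foldl-upTo-suc _ (suc A)) (cong (λ b → fillStep b (suc A)) (foldl-upTo-suc _ A))) ⟩
    map (fromMaybe 0) (fillStep (fillStep (foldl fillStep (initBracket ρ) (upTo A)) A) (suc A)) ∎

module _ (C A k : ℕ) (μ : Path) where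
  open BracketSteps (ν̂ C A k) μ

  fillStep-below : ∀ p R → p < A → countVal p (ys μ) ≡ 2 →
    fillStep (holes (suc C) ++ justs (upTo A) ++ R) p ≡ holes C ++ justs (p ∷ upTo A) ++ R
  fillStep-below p R p<A count≡2 = begin
    fillLeft p (countVal p (ys μ) ∸ 1) (fixedPos (ν̂ C A k) p) (holes (suc C) ++ justs (upTo A) ++ R)
      ≡⟨ cong₂ (λ n j → fillLeft p n j (holes (suc C) ++ justs (upTo A) ++ R)) (cong (_∸ 1) count≡2) (trans (fixedPos-ν̂-< C A k p p<A) (sym length-F)) ⟩
    fillLeft p 1 (length F) (holes (suc C) ++ justs (upTo A) ++ R)
      ≡⟨ cong (fillLeft p 1 (length F)) split ⟩
    fillLeft p 1 (length F) (F ++ justs (drop p (upTo A)) ++ R)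
      ≡⟨ fillLeft-++ p 1 F _ ⟩
    fillʳ p 1 (holes (suc C) ++ justs (take p (upTo A))) ++ justs (drop p (upTo A)) ++ R
      ≡⟨ cong (_++ justs (drop p (upTo A)) ++ R) (fillʳ-justs p 1 (holes (suc C)) (take p (upTo A))) ⟩
    (fillʳ p 1 (holes (suc C)) ++ justs (take p (upTo A))) ++ justs (drop p (upTo A)) ++ R
      ≡⟨ cong (λ xs → (xs ++ justs (take p (upTo A))) ++ justs (drop p (upTo A)) ++ R)
           (trans (cong (λ n → fillʳ p 1 (holes n)) (+-comm 1 C)) (fillʳ-holes-≤ p 1 C [])) ⟩
    ((holes C ++ just p ∷ []) ++ justs (take p (upTo A))) ++ justs (drop p (upTo A)) ++ R
      ≡⟨ trans (++-assoc (holes C ++ just p ∷ []) _ _) (++-assoc (holes C) (just p ∷ []) _) ⟩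
    holes C ++ just p ∷ justs (take p (upTo A)) ++ justs (drop p (upTo A)) ++ R
      ≡⟨ cong (λ xs → holes C ++ just p ∷ xs) (trans (sym (++-assoc (justs (take p (upTo A))) _ _))
           (cong (_++ R) (trans (sym (map-++ just (take p (upTo A)) _)) (cong justs (take++drop≡id p (upTo A)))))) ⟩
    holes C ++ justs (p ∷ upTo A) ++ R ∎
    where
    F = holes (suc C) ++ justs (take p (upTo A))
    length-F : length F ≡ suc C + p
    length-F = trans (length-++ (holes (suc C)))
      (cong₂ _+_ (length-replicate (suc C)) (trans (length-map just (take p (upTo A)))
        (trans (length-take p (upTo A)) (trans (cong (p ⊓_) (length-upTo A)) (m≤n⇒m⊓n≡m (<⇒≤ p<A))))))
    split : holes (suc C) ++ justs (upTo A) ++ R ≡ F ++ justs (drop p (upTo A)) ++ R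
    split = begin
      holes (suc C) ++ justs (upTo A) ++ R
        ≡⟨ cong (λ xs → holes (suc C) ++ justs xs ++ R) (sym (take++drop≡id p (upTo A))) ⟩
      holes (suc C) ++ justs (take p (upTo A) ++ drop p (upTo A)) ++ R
        ≡⟨ cong (λ xs → holes (suc C) ++ xs ++ R) (map-++ just (take p (upTo A)) _) ⟩
      holes (suc C) ++ (justs (take p (upTo A)) ++ justs (drop p (upTo A))) ++ R
        ≡⟨ cong (holes (suc C) ++_) (++-assoc (justs (take p (upTo A))) _ _) ⟩
      holes (suc C) ++ justs (take p (upTo A)) ++ justs (drop p (upTo A)) ++ R
        ≡⟨ sym (++-assoc (holes (suc C)) _ _) ⟩
      F ++ justs (drop p (upTo A)) ++ R ∎

  fillStep-top : ∀ c W g s → c + length W ≡ suc C + A → countVal A (ys μ) ≡ suc g → countVal (suc A) (ys μ) ≡ suc s →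
    fillStep (fillStep (holes c ++ justs W ++ holes k ++ just A ∷ just (suc A) ∷ []) A) (suc A)
      ≡ fillʳ (suc A) s (fillʳ A g (holes c ++ justs W ++ holes k)) ++ just A ∷ just (suc A) ∷ []
  fillStep-top c W g s ∣c+W∣ countA countA+1 = begin
    fillStep (fillLeft A (countVal A (ys μ) ∸ 1) (fixedPos (ν̂ C A k) A) (holes c ++ justs W ++ holes k ++ just A ∷ just (suc A) ∷ [])) (suc A)
      ≡⟨ cong₂ (λ n j → fillStep (fillLeft A n j (holes c ++ justs W ++ holes k ++ just A ∷ just (suc A) ∷ [])) (suc A))
               (cong (_∸ 1) countA) (trans (fixedPos-ν̂-A C A k) (sym length-Q)) ⟩
    fillStep (fillLeft A g (length Q) (holes c ++ justs W ++ holes k ++ just A ∷ just (suc A) ∷ [])) (suc A)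
      ≡⟨ cong (λ xs → fillStep (fillLeft A g (length Q) xs) (suc A)) reassoc ⟩
    fillStep (fillLeft A g (length Q) (Q ++ just A ∷ just (suc A) ∷ [])) (suc A)
      ≡⟨ cong (λ xs → fillStep xs (suc A)) (fillLeft-++ A g Q _) ⟩
    fillLeft (suc A) (countVal (suc A) (ys μ) ∸ 1) (fixedPos (ν̂ C A k) (suc A)) (fillʳ A g Q ++ just A ∷ just (suc A) ∷ [])
      ≡⟨ cong₂ (λ n j → fillLeft (suc A) n j (fillʳ A g Q ++ just A ∷ just (suc A) ∷ [])) (cong (_∸ 1) countA+1) (trans (fixedPos-ν̂-top C A k) (sym length-Q′)) ⟩
    fillLeft (suc A) s (length (fillʳ A g Q ++ justs (A ∷ []))) (fillʳ A g Q ++ just A ∷ just (suc A) ∷ [])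
      ≡⟨ cong (fillLeft (suc A) s (length (fillʳ A g Q ++ justs (A ∷ [])))) (sym (++-assoc (fillʳ A g Q) (just A ∷ []) _)) ⟩
    fillLeft (suc A) s (length (fillʳ A g Q ++ justs (A ∷ []))) ((fillʳ A g Q ++ justs (A ∷ [])) ++ just (suc A) ∷ [])
      ≡⟨ fillLeft-++ (suc A) s (fillʳ A g Q ++ justs (A ∷ [])) _ ⟩
    fillʳ (suc A) s (fillʳ A g Q ++ justs (A ∷ [])) ++ just (suc A) ∷ []
      ≡⟨ cong (_++ just (suc A) ∷ []) (fillʳ-justs (suc A) s (fillʳ A g Q) (A ∷ [])) ⟩
    (fillʳ (suc A) s (fillʳ A g Q) ++ just A ∷ []) ++ just (suc A) ∷ []
      ≡⟨ ++-assoc (fillʳ (suc A) s (fillʳ A g Q)) _ _ ⟩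
    fillʳ (suc A) s (fillʳ A g Q) ++ just A ∷ just (suc A) ∷ [] ∎
    where
    Q = holes c ++ justs W ++ holes k
    reassoc : holes c ++ justs W ++ holes k ++ just A ∷ just (suc A) ∷ [] ≡ Q ++ just A ∷ just (suc A) ∷ []
    reassoc = trans (cong (holes c ++_) (sym (++-assoc (justs W) _ _))) (sym (++-assoc (holes c) _ _))
    length-Q : length Q ≡ suc C + A + k
    length-Q = begin
      length Q ≡⟨ length-++ (holes c) ⟩
      length (holes c) + length (justs W ++ holes k) ≡⟨ cong₂ _+_ (length-replicate c) (length-++ (justs W)) ⟩
      c + (length (justs W) + length (holes k)) ≡⟨ cong₂ (λ m n → c + (m + n)) (length-map just W) (length-replicate k) ⟩
      c + (length W + k) ≡⟨ sym (+-assoc c (length W) k) ⟩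
      c + length W + k ≡⟨ cong (_+ k) ∣c+W∣ ⟩
      suc C + A + k ∎
    length-Q′ : length (fillʳ A g Q ++ justs (A ∷ [])) ≡ suc (suc C + A + k)
    length-Q′ = trans (length-++ (fillʳ A g Q)) (trans (cong (_+ 1) (trans (length-fillʳ A g Q) length-Q)) (+-comm _ 1))

private
  +-rotate : ∀ c g d → c + (g + d) ≡ g + (d + c)
  +-rotate = solve-∀
  +-rotate″ : ∀ k e s → suc (k + (e + s)) ≡ suc k + e + s
  +-rotate″ = solve-∀

module _ (C A k : ℕ) (A≡0⇒k≡0 : A ≡ 0 → k ≡ 0) (μ : Path) where
  open BracketSteps (ν̂ C A k) μ

  private
    simp-of : ∀ P x K → length P ≡ C → length K ≡ k → bracket (ν̂ C A k) μ ≡ P ++ x ∷ upTo A ++ K ++ A ∷ suc A ∷ [] →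
      simpS (suc A) (suc (C + k)) k μ ≡ x × simpT (suc A) (suc (C + k)) k μ ≡ countVal (suc A) P + countVal (suc A) K
    simp-of = simp-from-bracket C A k A≡0⇒k≡0 μ

    bracket-from : ∀ c W g s → c + length W ≡ suc C + A → countVal A (ys μ) ≡ suc g → countVal (suc A) (ys μ) ≡ suc s →
      foldl fillStep (initBracket (ν̂ C A k)) (upTo A) ≡ holes c ++ justs W ++ holes k ++ just A ∷ just (suc A) ∷ [] →
      ∀ xs → fillʳ (suc A) s (fillʳ A g (holes c ++ justs W ++ holes k)) ≡ justs xs →
      bracket (ν̂ C A k) μ ≡ xs ++ A ∷ suc A ∷ []
    bracket-from c W g s ∣c+W∣ countA countA+1 low xs filled = begin
      bracket (ν̂ C A k) μ
        ≡⟨ bracket-unfold A (countN-ν̂ C A k) ⟩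
      map (fromMaybe 0) (fillStep (fillStep (foldl fillStep (initBracket (ν̂ C A k)) (upTo A)) A) (suc A))
        ≡⟨ cong (λ V → map (fromMaybe 0) (fillStep (fillStep V A) (suc A))) low ⟩
      map (fromMaybe 0) (fillStep (fillStep (holes c ++ justs W ++ holes k ++ just A ∷ just (suc A) ∷ []) A) (suc A))
        ≡⟨ cong (map (fromMaybe 0)) (fillStep-top C A k μ c W g s ∣c+W∣ countA countA+1) ⟩
      map (fromMaybe 0) (fillʳ (suc A) s (fillʳ A g (holes c ++ justs W ++ holes k)) ++ justs (A ∷ suc A ∷ []))
        ≡⟨ cong (λ ys → map (fromMaybe 0) (ys ++ justs (A ∷ suc A ∷ []))) filled ⟩
      map (fromMaybe 0) (justs xs ++ justs (A ∷ suc A ∷ []))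
        ≡⟨ trans (cong (map (fromMaybe 0)) (sym (map-++ just xs _))) (fromMaybe-justs 0 _) ⟩
      xs ++ A ∷ suc A ∷ [] ∎

    ++-∷-++-assoc : ∀ P (x : ℕ) M K T → (P ++ x ∷ M ++ K) ++ T ≡ P ++ x ∷ M ++ K ++ T
    ++-∷-++-assoc P x M K T = trans (++-assoc P (x ∷ M ++ K) T) (cong (λ ys → P ++ x ∷ ys) (++-assoc M K T))

    countVal-tops : ∀ n m → countVal (suc A) (replicate n (suc A) ++ replicate m A) ≡ n
    countVal-tops n m = trans (countVal-++ (suc A) (replicate n (suc A)) _)
      (trans (cong₂ _+_ (countVal-replicate (suc A) n) (countVal-absent (suc A) _ (replicate-≢ m (<⇒≢ (n<1+n A))))) (+-identityʳ n))

    low-skip : (∀ i → i < A → countVal i (ys μ) ≤ 1) →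
      foldl fillStep (initBracket (ν̂ C A k)) (upTo A) ≡ holes (suc C) ++ justs (upTo A) ++ holes k ++ just A ∷ just (suc A) ∷ []
    low-skip ≤1 = trans (foldl-skip _ A ≤1) (initBracket-ν̂ C A k)

  simp-at-≤ : ∀ g s → (∀ i → i < A → countVal i (ys μ) ≤ 1) → countVal A (ys μ) ≡ suc g → countVal (suc A) (ys μ) ≡ suc s →
    g + s ≡ suc (C + k) → g ≤ k → simpS (suc A) (suc (C + k)) k μ ≡ suc A × simpT (suc A) (suc (C + k)) k μ ≡ pred s
  simp-at-≤ g s ≤1 countA countA+1 g+s≡ g≤k with m≤n⇒∃[o]m+o≡n g≤k
  ... | d , g+d≡k = map₂ (λ T≡ → trans T≡ count≡) (simp-of (replicate C (suc A)) (suc A) K (length-replicate C) ∣K∣ bracket≡)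
    where
    s≡ : s ≡ d + suc C
    s≡ = +-cancelˡ-≡ g s (d + suc C) (trans g+s≡ (trans (cong (λ k′ → suc (C + k′)) (sym g+d≡k)) (+-rotate (suc C) g d)))
    K = replicate d (suc A) ++ replicate g A
    ∣K∣ : length K ≡ k
    ∣K∣ = trans (length-++ (replicate d (suc A))) (trans (cong₂ _+_ (length-replicate d) (length-replicate g)) (trans (+-comm d g) g+d≡k))
    filled : fillʳ (suc A) s (fillʳ A g (holes (suc C) ++ justs (upTo A) ++ holes k)) ≡ justs (replicate C (suc A) ++ suc A ∷ upTo A ++ K)
    filled = trans (cong₂ (λ s′ k′ → fillʳ (suc A) s′ (fillʳ A g (holes (suc C) ++ justs (upTo A) ++ holes k′))) s≡ (sym (trans (+-comm d g) g+d≡k)))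
                   (trans (fillʳ-fillʳ-≤ (suc A) A (suc C) d g (upTo A)) (cong justs (sym (replicate-++-∷ C (suc A) _))))
    bracket≡ = trans (bracket-from (suc C) (upTo A) g s (cong (suc C +_) (length-upTo A)) countA countA+1 (low-skip ≤1) _ filled)
                     (++-∷-++-assoc (replicate C (suc A)) (suc A) (upTo A) K _)
    count≡ : countVal (suc A) (replicate C (suc A)) + countVal (suc A) K ≡ pred s
    count≡ = trans (cong₂ _+_ (countVal-replicate (suc A) C) (countVal-tops d g)) (trans (+-comm C d) (sym (trans (cong pred s≡) (cong pred (+-suc d C)))))

  simp-at-> : ∀ g s → (∀ i → i < A → countVal i (ys μ) ≤ 1) → countVal A (ys μ) ≡ suc g → countVal (suc A) (ys μ) ≡ suc s →
    g + s ≡ suc (C + k) → k < g → simpS (suc A) (suc (C + k)) k μ ≡ A × simpT (suc A) (suc (C + k)) k μ ≡ s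
  simp-at-> g s ≤1 countA countA+1 g+s≡ k<g with m≤n⇒∃[o]m+o≡n k<g
  ... | e , k+1+e≡g = map₂ (λ T≡ → trans T≡ count≡) (simp-of P A (replicate k A) ∣P∣ (length-replicate k) bracket≡)
    where
    e+s≡C : e + s ≡ C
    e+s≡C = +-cancelˡ-≡ k (e + s) C (suc-injective (trans (+-rotate″ k e s) (trans (cong (_+ s) k+1+e≡g) (trans g+s≡ (cong suc (+-comm C k))))))
    P = replicate s (suc A) ++ replicate e A
    ∣P∣ : length P ≡ C
    ∣P∣ = trans (length-++ (replicate s (suc A))) (trans (cong₂ _+_ (length-replicate s) (length-replicate e)) (trans (+-comm s e) e+s≡C))
    filled : fillʳ (suc A) s (fillʳ A g (holes (suc C) ++ justs (upTo A) ++ holes k)) ≡ justs (P ++ A ∷ upTo A ++ replicate k A)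
    filled = trans (cong₂ (λ g′ c′ → fillʳ (suc A) s (fillʳ A g′ (holes c′ ++ justs (upTo A) ++ holes k)))
                      (trans (sym k+1+e≡g) (sym (+-suc k e))) (sym (trans (+-suc s e) (cong suc (trans (+-comm s e) e+s≡C)))))
             (trans (fillʳ-fillʳ-≥ (suc A) A s (suc e) k (upTo A))
               (cong justs (trans (cong (replicate s (suc A) ++_) (sym (replicate-++-∷ e A _))) (sym (++-assoc (replicate s (suc A)) _ _)))))
    bracket≡ = trans (bracket-from (suc C) (upTo A) g s (cong (suc C +_) (length-upTo A)) countA countA+1 (low-skip ≤1) _ filled)
                     (++-∷-++-assoc P A (upTo A) (replicate k A) _)
    count≡ : countVal (suc A) P + countVal (suc A) (replicate k A) ≡ s
    count≡ = trans (cong₂ _+_ (countVal-tops s e) (countVal-absent (suc A) _ (replicate-≢ k (<⇒≢ (n<1+n A))))) (+-identityʳ s)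

  simp-below : ∀ p g s → p < A → (∀ i → i < A → i ≢ p → countVal i (ys μ) ≤ 1) → countVal p (ys μ) ≡ 2 →
    countVal A (ys μ) ≡ suc g → countVal (suc A) (ys μ) ≡ suc s → g + s ≡ C + k →
    simpS (suc A) (suc (C + k)) k μ ≡ p × simpT (suc A) (suc (C + k)) k μ ≡ s
  simp-below p g s p<A ≤1 countp countA countA+1 g+s≡ = by-cases (g ≤? k)
    where
    C+∣W∣ : C + length (p ∷ upTo A) ≡ suc C + A
    C+∣W∣ = trans (cong (λ n → C + suc n) (length-upTo A)) (+-suc C A)
    low : foldl fillStep (initBracket (ν̂ C A k)) (upTo A) ≡ holes C ++ justs (p ∷ upTo A) ++ holes k ++ just A ∷ just (suc A) ∷ []
    low = trans (foldl-single _ A p p<A ≤1) (trans (cong (λ V → fillStep V p) (initBracket-ν̂ C A k)) (fillStep-below C A k μ p _ p<A countp))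

    below-≤ : (Σ ℕ λ d → g + d ≡ k) → simpS (suc A) (suc (C + k)) k μ ≡ p × simpT (suc A) (suc (C + k)) k μ ≡ s
    below-≤ (d , g+d≡k) = map₂ (λ T≡ → trans T≡ count≡) (simp-of (replicate C (suc A)) p K (length-replicate C) ∣K∣ bracket≡)
      where
      s≡ : s ≡ d + C
      s≡ = +-cancelˡ-≡ g s (d + C) (trans g+s≡ (trans (cong (C +_) (sym g+d≡k)) (+-rotate C g d)))
      K = replicate d (suc A) ++ replicate g A
      ∣K∣ : length K ≡ k
      ∣K∣ = trans (length-++ (replicate d (suc A))) (trans (cong₂ _+_ (length-replicate d) (length-replicate g)) (trans (+-comm d g) g+d≡k))
      filled : fillʳ (suc A) s (fillʳ A g (holes C ++ justs (p ∷ upTo A) ++ holes k)) ≡ justs (replicate C (suc A) ++ p ∷ upTo A ++ K)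
      filled = trans (cong₂ (λ s′ k′ → fillʳ (suc A) s′ (fillʳ A g (holes C ++ justs (p ∷ upTo A) ++ holes k′))) s≡ (sym (trans (+-comm d g) g+d≡k)))
                     (fillʳ-fillʳ-≤ (suc A) A C d g (p ∷ upTo A))
      bracket≡ = trans (bracket-from C (p ∷ upTo A) g s C+∣W∣ countA countA+1 low _ filled) (++-∷-++-assoc (replicate C (suc A)) p (upTo A) K _)
      count≡ : countVal (suc A) (replicate C (suc A)) + countVal (suc A) K ≡ s
      count≡ = trans (cong₂ _+_ (countVal-replicate (suc A) C) (countVal-tops d g)) (trans (+-comm C d) (sym s≡))

    below-> : (Σ ℕ λ e → suc k + e ≡ g) → simpS (suc A) (suc (C + k)) k μ ≡ p × simpT (suc A) (suc (C + k)) k μ ≡ s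
    below-> (e , k+1+e≡g) = map₂ (λ T≡ → trans T≡ count≡) (simp-of P p (replicate k A) ∣P∣ (length-replicate k) bracket≡)
      where
      C≡ : C ≡ s + suc e
      C≡ = sym (trans (+-suc s e) (trans (cong suc (+-comm s e))
             (+-cancelˡ-≡ k (suc (e + s)) C (trans (+-suc k (e + s)) (trans (+-rotate″ k e s) (trans (cong (_+ s) k+1+e≡g) (trans g+s≡ (+-comm C k))))))))
      P = replicate s (suc A) ++ replicate (suc e) A
      ∣P∣ : length P ≡ C
      ∣P∣ = trans (length-++ (replicate s (suc A))) (trans (cong₂ _+_ (length-replicate s) (length-replicate (suc e))) (sym C≡))
      filled : fillʳ (suc A) s (fillʳ A g (holes C ++ justs (p ∷ upTo A) ++ holes k)) ≡ justs (P ++ p ∷ upTo A ++ replicate k A)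
      filled = trans (cong₂ (λ g′ c′ → fillʳ (suc A) s (fillʳ A g′ (holes c′ ++ justs (p ∷ upTo A) ++ holes k))) (trans (sym k+1+e≡g) (sym (+-suc k e))) C≡)
                     (trans (fillʳ-fillʳ-≥ (suc A) A s (suc e) k (p ∷ upTo A)) (cong justs (sym (++-assoc (replicate s (suc A)) _ _))))
      bracket≡ = trans (bracket-from C (p ∷ upTo A) g s C+∣W∣ countA countA+1 low _ filled) (++-∷-++-assoc P p (upTo A) (replicate k A) _)
      count≡ : countVal (suc A) P + countVal (suc A) (replicate k A) ≡ s
      count≡ = trans (cong₂ _+_ (countVal-tops s (suc e)) (countVal-absent (suc A) _ (replicate-≢ k (<⇒≢ (n<1+n A))))) (+-identityʳ s)

    by-cases : Dec (g ≤ k) → simpS (suc A) (suc (C + k)) k μ ≡ p × simpT (suc A) (suc (C + k)) k μ ≡ s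
    by-cases (yes g≤k) = below-≤ (m≤n⇒∃[o]m+o≡n g≤k)
    by-cases (no g≰k)  = below-> (m≤n⇒∃[o]m+o≡n (≰⇒> g≰k))

zigzag : ℕ → ℕ → ℕ → ℕ → Path
zigzag p q r s = replicate p N ++ E ∷ replicate q N ++ replicate r E ++ N ∷ replicate s E

corner : ℕ → ℕ → Path
corner a b = replicate a N ++ replicate b E

ys-zigzag : ∀ p q r s →
  ys (zigzag p q r s) ≡ (0 ∷ ascending 0 p) ++ p ∷ ascending p q ++ replicate r (q + p) ++ replicate (suc s) (suc (q + p))
ys-zigzag p q r s = begin
  ys (zigzag p q r s)
    ≡⟨ ys≡0∷ysFrom (zigzag p q r s) ⟩
  0 ∷ ysFrom 0 (replicate p N ++ E ∷ tail)
    ≡⟨ cong (0 ∷_) (ysFrom-++ 0 (replicate p N) (E ∷ tail)) ⟩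
  0 ∷ ysFrom 0 (replicate p N) ++ ysFrom (endY 0 (replicate p N)) (E ∷ tail)
    ≡⟨ cong₂ (λ as y → 0 ∷ as ++ ysFrom y (E ∷ tail)) (ysFrom-Nⁿ 0 p) (trans (endY-Nⁿ 0 p) (+-identityʳ p)) ⟩
  0 ∷ ascending 0 p ++ p ∷ ysFrom p (replicate q N ++ replicate r E ++ N ∷ replicate s E)
    ≡⟨ cong (λ as → 0 ∷ ascending 0 p ++ p ∷ as) (ysFrom-++ p (replicate q N) _) ⟩
  0 ∷ ascending 0 p ++ p ∷ ysFrom p (replicate q N) ++ ysFrom (endY p (replicate q N)) (replicate r E ++ N ∷ replicate s E)
    ≡⟨ cong₂ (λ as y → 0 ∷ ascending 0 p ++ p ∷ as ++ ysFrom y (replicate r E ++ N ∷ replicate s E)) (ysFrom-Nⁿ p q) (endY-Nⁿ p q) ⟩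
  0 ∷ ascending 0 p ++ p ∷ ascending p q ++ ysFrom (q + p) (replicate r E ++ N ∷ replicate s E)
    ≡⟨ cong (λ as → 0 ∷ ascending 0 p ++ p ∷ ascending p q ++ as) (ysFrom-++ (q + p) (replicate r E) (N ∷ replicate s E)) ⟩
  0 ∷ ascending 0 p ++ p ∷ ascending p q ++ ysFrom (q + p) (replicate r E) ++ ysFrom (endY (q + p) (replicate r E)) (N ∷ replicate s E)
    ≡⟨ cong₂ (λ as y → 0 ∷ ascending 0 p ++ p ∷ ascending p q ++ as ++ ysFrom y (N ∷ replicate s E)) (ysFrom-Eⁿ (q + p) r) (endY-Eⁿ (q + p) r) ⟩
  0 ∷ ascending 0 p ++ p ∷ ascending p q ++ replicate r (q + p) ++ suc (q + p) ∷ ysFrom (suc (q + p)) (replicate s E)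
    ≡⟨ cong (λ as → 0 ∷ ascending 0 p ++ p ∷ ascending p q ++ replicate r (q + p) ++ suc (q + p) ∷ as) (ysFrom-Eⁿ (suc (q + p)) s) ⟩
  0 ∷ ascending 0 p ++ p ∷ ascending p q ++ replicate r (q + p) ++ replicate (suc s) (suc (q + p)) ∎
  where tail = replicate q N ++ replicate r E ++ N ∷ replicate s E

ys-corner : ∀ a b → ys (corner a b) ≡ (0 ∷ ascending 0 a) ++ replicate b a
ys-corner a b = begin
  ys (corner a b)
    ≡⟨ ys≡0∷ysFrom (corner a b) ⟩
  0 ∷ ysFrom 0 (replicate a N ++ replicate b E)
    ≡⟨ cong (0 ∷_) (ysFrom-++ 0 (replicate a N) (replicate b E)) ⟩
  0 ∷ ysFrom 0 (replicate a N) ++ ysFrom (endY 0 (replicate a N)) (replicate b E)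
    ≡⟨ cong₂ (λ as y → 0 ∷ as ++ ysFrom y (replicate b E)) (ysFrom-Nⁿ 0 a) (trans (endY-Nⁿ 0 a) (+-identityʳ a)) ⟩
  0 ∷ ascending 0 a ++ ysFrom a (replicate b E)
    ≡⟨ cong (λ as → 0 ∷ ascending 0 a ++ as) (ysFrom-Eⁿ a b) ⟩
  0 ∷ ascending 0 a ++ replicate b a ∎

countVal-0∷ascending-≤ : ∀ i n → i ≤ n → countVal i (0 ∷ ascending 0 n) ≡ 1
countVal-0∷ascending-≤ zero    n _   = cong suc (countVal-ascending-≤ 0 0 n z≤n)
countVal-0∷ascending-≤ (suc i) n i<n = countVal-ascending-∈ (suc i) 0 n (s≤s z≤n) (subst (suc i ≤_) (sym (+-identityʳ n)) i<n)

countVal-0∷ascending-> : ∀ i n → n < i → countVal i (0 ∷ ascending 0 n) ≡ 0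
countVal-0∷ascending-> (suc i) n n<i = countVal-ascending-> (suc i) 0 n (subst (_< suc i) (sym (+-identityʳ n)) n<i)

countVal-≢ : ∀ {i x} n → x ≢ i → countVal i (replicate n x) ≡ 0
countVal-≢ n x≢i = countVal-absent _ _ (replicate-≢ n x≢i)

countVal-zigzag : ∀ i p q r s → countVal i (ys (zigzag p q r s)) ≡
  countVal i (0 ∷ ascending 0 p) + (countVal i (p ∷ []) + (countVal i (ascending p q) + (countVal i (replicate r (q + p)) + countVal i (replicate (suc s) (suc (q + p))))))
countVal-zigzag i p q r s = begin
  countVal i (ys (zigzag p q r s))
    ≡⟨ cong (countVal i) (ys-zigzag p q r s) ⟩
  countVal i (H ++ (p ∷ []) ++ ascending p q ++ R ++ T)
    ≡⟨ countVal-++ i H _ ⟩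
  countVal i H + countVal i ((p ∷ []) ++ ascending p q ++ R ++ T)
    ≡⟨ cong (countVal i H +_) (countVal-++ i (p ∷ []) (ascending p q ++ R ++ T)) ⟩
  countVal i H + (countVal i (p ∷ []) + countVal i (ascending p q ++ R ++ T))
    ≡⟨ cong (λ n → countVal i H + (countVal i (p ∷ []) + n)) (trans (countVal-++ i (ascending p q) _) (cong (countVal i (ascending p q) +_) (countVal-++ i R T))) ⟩
  countVal i H + (countVal i (p ∷ []) + (countVal i (ascending p q) + (countVal i R + countVal i T))) ∎
  where
  H = 0 ∷ ascending 0 p
  R = replicate r (q + p)
  T = replicate (suc s) (suc (q + p))

countVal-zigzag-other : ∀ i p q r s → i < q + p → i ≢ p → countVal i (ys (zigzag p q r s)) ≡ 1
countVal-zigzag-other i p q r s i<A i≢p with <-cmp i p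
... | tri< i<p _ _ rewrite countVal-zigzag i p q r s | countVal-0∷ascending-≤ i p (<⇒≤ i<p) | countVal-≢ {i} 1 (>⇒≢ i<p)
  | countVal-ascending-≤ i p q (<⇒≤ i<p) | countVal-≢ r (>⇒≢ i<A) | countVal-≢ (suc s) (>⇒≢ (m<n⇒m<1+n i<A)) = refl
... | tri≈ _ i≡p _ = ⊥-elim (i≢p i≡p)
... | tri> _ _ p<i rewrite countVal-zigzag i p q r s | countVal-0∷ascending-> i p p<i | countVal-≢ {i} 1 (<⇒≢ p<i)
  | countVal-ascending-∈ i p q p<i (<⇒≤ i<A) | countVal-≢ r (>⇒≢ i<A) | countVal-≢ (suc s) (>⇒≢ (m<n⇒m<1+n i<A)) = refl

countVal-zigzag-first : ∀ p q r s → countVal p (ys (zigzag p (suc q) r s)) ≡ 2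
countVal-zigzag-first p q r s rewrite countVal-zigzag p p (suc q) r s | countVal-0∷ascending-≤ p p ≤-refl | countVal-replicate p 1
  | countVal-ascending-≤ p p (suc q) ≤-refl | countVal-≢ r (>⇒≢ (s≤s (m≤n+m p q))) | countVal-≢ (suc s) (>⇒≢ (m<n⇒m<1+n (s≤s (m≤n+m p q)))) = refl

countVal-zigzag-second : ∀ p q r s → countVal (suc q + p) (ys (zigzag p (suc q) r s)) ≡ suc r
countVal-zigzag-second p q r s rewrite countVal-zigzag (suc q + p) p (suc q) r s | countVal-0∷ascending-> (suc q + p) p (s≤s (m≤n+m p q))
  | countVal-≢ {suc q + p} 1 (<⇒≢ (s≤s (m≤n+m p q))) | countVal-ascending-∈ (suc q + p) p (suc q) (s≤s (m≤n+m p q)) ≤-refl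
  | countVal-replicate (suc q + p) r | countVal-≢ (suc s) (>⇒≢ (n<1+n (suc q + p))) = cong suc (+-identityʳ r)

countVal-zigzag-flat : ∀ p r s → countVal p (ys (zigzag p 0 r s)) ≡ suc (suc r)
countVal-zigzag-flat p r s rewrite countVal-zigzag p p 0 r s | countVal-0∷ascending-≤ p p ≤-refl | countVal-replicate p 1
  | countVal-replicate p r | countVal-≢ (suc s) (>⇒≢ (n<1+n p)) = cong (λ n → suc (suc n)) (+-identityʳ r)

countVal-zigzag-top : ∀ p q r s → countVal (suc (q + p)) (ys (zigzag p q r s)) ≡ suc s
countVal-zigzag-top p q r s rewrite countVal-zigzag (suc (q + p)) p q r s | countVal-0∷ascending-> (suc (q + p)) p (s≤s (m≤n+m p q))
  | countVal-≢ {suc (q + p)} 1 (<⇒≢ (s≤s (m≤n+m p q))) | countVal-ascending-> (suc (q + p)) p q (n<1+n (q + p))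
  | countVal-≢ {suc (q + p)} r (<⇒≢ (n<1+n (q + p))) | countVal-replicate (suc (q + p)) (suc s) = refl

countVal-corner-≤ : ∀ i a b → i < a → countVal i (ys (corner a b)) ≡ 1
countVal-corner-≤ i a b i<a = trans (cong (countVal i) (ys-corner a b))
  (trans (countVal-++ i (0 ∷ ascending 0 a) _) (cong₂ _+_ (countVal-0∷ascending-≤ i a (<⇒≤ i<a)) (countVal-≢ b (>⇒≢ i<a))))

countVal-corner-top : ∀ a b → countVal a (ys (corner a b)) ≡ suc b
countVal-corner-top a b = trans (cong (countVal a) (ys-corner a b))
  (trans (countVal-++ a (0 ∷ ascending 0 a) _) (cong₂ _+_ (countVal-0∷ascending-≤ a a ≤-refl) (countVal-replicate a b)))

pointsFrom-Nⁿ-++ : ∀ x y n zs → pointsFrom x y (replicate n N ++ zs) ≡ pointsFrom x y (replicate n N) ++ pointsFrom x (n + y) zs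
pointsFrom-Nⁿ-++ x y zero    zs = refl
pointsFrom-Nⁿ-++ x y (suc n) zs = cong ((x , suc y) ∷_)
  (trans (pointsFrom-Nⁿ-++ x (suc y) n zs) (cong (λ y′ → pointsFrom x (suc y) (replicate n N) ++ pointsFrom x y′ zs) (+-suc n y)))

pointsFrom-Eⁿ-++ : ∀ x y n zs → pointsFrom x y (replicate n E ++ zs) ≡ pointsFrom x y (replicate n E) ++ pointsFrom (n + x) y zs
pointsFrom-Eⁿ-++ x y zero    zs = refl
pointsFrom-Eⁿ-++ x y (suc n) zs = cong ((suc x , y) ∷_)
  (trans (pointsFrom-Eⁿ-++ (suc x) y n zs) (cong (λ x′ → pointsFrom (suc x) y (replicate n E) ++ pointsFrom x′ y zs) (+-suc n x)))

points-zigzag : ∀ p q r s → points (zigzag p q r s) ≡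
  (0 , 0) ∷ pointsFrom 0 0 (replicate p N) ++ (1 , p + 0) ∷ pointsFrom 1 (p + 0) (replicate q N) ++
  pointsFrom 1 (q + (p + 0)) (replicate r E) ++ (r + 1 , suc (q + (p + 0))) ∷ pointsFrom (r + 1) (suc (q + (p + 0))) (replicate s E)
points-zigzag p q r s = cong ((0 , 0) ∷_) (trans (pointsFrom-Nⁿ-++ 0 0 p _) (cong (λ ps → pointsFrom 0 0 (replicate p N) ++ (1 , p + 0) ∷ ps)
  (trans (pointsFrom-Nⁿ-++ 1 (p + 0) q _) (cong (pointsFrom 1 (p + 0) (replicate q N) ++_) (pointsFrom-Eⁿ-++ 1 (q + (p + 0)) r (N ∷ replicate s E))))))

Above : ℕ → ℕ → ℕ × ℕ → Set
Above A B (x , y) = x ≤ 1 ⊎ (x ≤ suc B × A ≤ y)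

Below : ℕ × ℕ → ℕ × ℕ → Set
Below (x , y) (x′ , y′) = x′ ≡ x × y′ ≤ y

module _ (A B : ℕ) where

  Above-Nⁿ : ∀ x y n → x ≤ 1 → All (Above A B) (pointsFrom x y (replicate n N))
  Above-Nⁿ x y zero    x≤1 = []
  Above-Nⁿ x y (suc n) x≤1 = inj₁ x≤1 ∷ Above-Nⁿ x (suc y) n x≤1

  Above-Eⁿ : ∀ x y n → A ≤ y → n + x ≤ suc B → All (Above A B) (pointsFrom x y (replicate n E))
  Above-Eⁿ x y zero    A≤y n+x≤ = []
  Above-Eⁿ x y (suc n) A≤y n+x≤ = inj₂ (≤-trans (s≤s (m≤n+m x n)) n+x≤ , A≤y) ∷ Above-Eⁿ (suc x) y n A≤y (≤-trans (≤-reflexive (+-suc n x)) n+x≤)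

  points-nu : points (nu (suc A) (suc B)) ≡ (0 , 0) ∷ (1 , 0) ∷ pointsFrom 1 0 (replicate A N) ++ pointsFrom 1 (A + 0) (replicate B E) ++ (B + 1 , suc (A + 0)) ∷ []
  points-nu = cong (λ ps → (0 , 0) ∷ (1 , 0) ∷ ps) (trans (pointsFrom-Nⁿ-++ 1 0 A _) (cong (pointsFrom 1 0 (replicate A N) ++_) (pointsFrom-Eⁿ-++ 1 (A + 0) B (N ∷ []))))

  Above-nu : All (Above A B) (points (nu (suc A) (suc B)))
  Above-nu rewrite points-nu = inj₁ z≤n ∷ inj₁ ≤-refl ∷ ++⁺ (Above-Nⁿ 1 0 A ≤-refl)
    (++⁺ (Above-Eⁿ 1 (A + 0) B A≤A+0 (≤-reflexive (+-comm B 1))) (inj₂ (≤-reflexive (+-comm B 1) , ≤-trans A≤A+0 (n≤1+n _)) ∷ []))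
    where A≤A+0 = ≤-reflexive (sym (+-identityʳ A))

  private
    Below-Eⁿ : ∀ x₀ y n x y′ → x₀ < x → x ≤ n + x₀ → y ≤ y′ → Any (Below (x , y′)) (pointsFrom x₀ y (replicate n E))
    Below-Eⁿ x₀ y zero    x y′ x₀<x x≤x₀ _   = ⊥-elim (<-irrefl refl (<-≤-trans x₀<x x≤x₀))
    Below-Eⁿ x₀ y (suc n) x y′ x₀<x x≤ y≤y′ with suc x₀ ≟ x
    ... | yes refl = here (refl , y≤y′)
    ... | no x₀+1≢x = there (Below-Eⁿ (suc x₀) y n x y′ (≤∧≢⇒< x₀<x x₀+1≢x) (≤-trans x≤ (≤-reflexive (sym (+-suc n x₀)))) y≤y′)

  Above⇒Any : ∀ x y → Above A B (x , y) → Any (Below (x , y)) (points (nu (suc A) (suc B)))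
  Above⇒Any zero          y _ rewrite points-nu = here (refl , z≤n)
  Above⇒Any (suc zero)    y _ rewrite points-nu = there (here (refl , z≤n))
  Above⇒Any (suc (suc x)) y (inj₁ (s≤s ()))
  Above⇒Any (suc (suc x)) y (inj₂ (x≤ , A≤y)) rewrite points-nu =
    there (there (++⁺ʳ (pointsFrom 1 0 (replicate A N)) (++⁺ˡ
      (Below-Eⁿ 1 (A + 0) B (suc (suc x)) y (s≤s (s≤s z≤n)) (≤-trans x≤ (≤-reflexive (+-comm 1 B))) (≤-trans (≤-reflexive (+-identityʳ A)) A≤y)))))

  Any⇒Above : ∀ x y → Any (Below (x , y)) (points (nu (suc A) (suc B))) → Above A B (x , y)
  Any⇒Above x y = All.lookupWith {R = λ _ → Above A B (x , y)} shift Above-nu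
    where
    shift : ∀ {pt} → Above A B pt → Below (x , y) pt → Above A B (x , y)
    shift {x′ , y′} (inj₁ x′≤1)        (refl , _)    = inj₁ x′≤1
    shift {x′ , y′} (inj₂ (x′≤ , A≤y′)) (refl , y′≤y) = inj₂ (x′≤ , ≤-trans A≤y′ y′≤y)

  countE-nu : countE (nu (suc A) (suc B)) ≡ suc B
  countE-nu = cong suc (trans (countE-++ (replicate A N) _)
    (cong₂ _+_ (countE-Nⁿ A) (trans (countE-++ (replicate B E) (N ∷ [])) (trans (cong (_+ 0) (countE-Eⁿ B)) (+-identityʳ B)))))

  countN-nu : countN (nu (suc A) (suc B)) ≡ suc A
  countN-nu = trans (countN-++ (replicate A N) _) (trans (cong₂ _+_ (countN-Nⁿ A) (trans (countN-++ (replicate B E) (N ∷ [])) (cong (_+ 1) (countN-Eⁿ B)))) (+-comm A 1))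

  isNuPath-intro : ∀ μ → countE μ ≡ suc B → countN μ ≡ suc A → All (Above A B) (points μ) → IsNuPath (nu (suc A) (suc B)) μ
  isNuPath-intro μ countE≡ countN≡ above = trans countE≡ (sym countE-nu) , trans countN≡ (sym countN-nu) , All.map (λ {pt} → Above⇒Any (proj₁ pt) (proj₂ pt)) above

  isNuPath-elim : ∀ μ → IsNuPath (nu (suc A) (suc B)) μ → countE μ ≡ suc B × countN μ ≡ suc A × All (Above A B) (points μ)
  isNuPath-elim μ (countE≡ , countN≡ , below) = trans countE≡ countE-nu , trans countN≡ countN-nu , All.map (λ {pt} → Any⇒Above (proj₁ pt) (proj₂ pt)) below

  Above-zigzag : ∀ p q r s → q + p ≡ A → r + s ≡ B → All (Above A B) (points (zigzag p q r s))
  Above-zigzag p q r s q+p≡A r+s≡B rewrite points-zigzag p q r s =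
    inj₁ z≤n ∷ ++⁺ (Above-Nⁿ 0 0 p z≤n) (inj₁ ≤-refl ∷ ++⁺ (Above-Nⁿ 1 (p + 0) q ≤-refl)
      (++⁺ (Above-Eⁿ 1 y r A≤y r+1≤) (inj₂ (r+1≤ , ≤-trans A≤y (n≤1+n y)) ∷ Above-Eⁿ (r + 1) (suc y) s (≤-trans A≤y (n≤1+n y)) s+r+1≤)))
    where
    y = q + (p + 0)
    A≤y : A ≤ y
    A≤y = ≤-reflexive (trans (sym q+p≡A) (cong (q +_) (sym (+-identityʳ p))))
    r+1≤ : r + 1 ≤ suc B
    r+1≤ = ≤-trans (≤-reflexive (+-comm r 1)) (s≤s (subst (r ≤_) r+s≡B (m≤m+n r s)))
    s+r+1≤ : s + (r + 1) ≤ suc B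
    s+r+1≤ = ≤-reflexive (trans (cong (s +_) (+-comm r 1)) (trans (+-suc s r) (cong suc (trans (+-comm s r) r+s≡B))))

  Above-corner : All (Above A B) (points (corner (suc A) (suc B)))
  Above-corner rewrite pointsFrom-Nⁿ-++ 0 0 (suc A) (replicate (suc B) E) =
    inj₁ z≤n ∷ ++⁺ (Above-Nⁿ 0 0 (suc A) z≤n)
      (Above-Eⁿ 0 (suc A + 0) (suc B) (≤-trans (n≤1+n A) (≤-reflexive (sym (+-identityʳ (suc A))))) (≤-reflexive (+-identityʳ (suc B))))

data NuPath (A B : ℕ) : Set where
  below : (p q r s : ℕ) → suc q + p ≡ A → r + s ≡ B → NuPath A B
  at    : (r s : ℕ) → r + s ≡ B → NuPath A B
  top   : NuPath A B

toPath : ∀ {A B} → NuPath A B → Path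
toPath     (below p q r s _ _) = zigzag p (suc q) r s
toPath {A} (at r s _)          = zigzag A 0 r s
toPath {A} {B} top             = corner (suc A) (suc B)

countE-zigzag : ∀ p q r s → countE (zigzag p q r s) ≡ suc (r + s)
countE-zigzag p q r s = begin
  countE (zigzag p q r s)
    ≡⟨ countE-++ (replicate p N) _ ⟩
  countE (replicate p N) + suc (countE (replicate q N ++ replicate r E ++ N ∷ replicate s E))
    ≡⟨ cong₂ (λ m n → m + suc n) (countE-Nⁿ p) (countE-++ (replicate q N) _) ⟩
  suc (countE (replicate q N) + countE (replicate r E ++ N ∷ replicate s E))
    ≡⟨ cong₂ (λ m n → suc (m + n)) (countE-Nⁿ q) (trans (countE-++ (replicate r E) _) (cong₂ _+_ (countE-Eⁿ r) (countE-Eⁿ s))) ⟩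
  suc (r + s) ∎

countN-zigzag : ∀ p q r s → countN (zigzag p q r s) ≡ suc (q + p)
countN-zigzag p q r s = begin
  countN (zigzag p q r s)
    ≡⟨ countN-++ (replicate p N) _ ⟩
  countN (replicate p N) + countN (replicate q N ++ replicate r E ++ N ∷ replicate s E)
    ≡⟨ cong₂ _+_ (countN-Nⁿ p) (countN-++ (replicate q N) _) ⟩
  p + (countN (replicate q N) + countN (replicate r E ++ N ∷ replicate s E))
    ≡⟨ cong₂ (λ m n → p + (m + n)) (countN-Nⁿ q) (trans (countN-++ (replicate r E) _) (cong₂ _+_ (countN-Eⁿ r) (cong suc (countN-Eⁿ s)))) ⟩
  p + (q + 1)
    ≡⟨ trans (cong (p +_) (+-comm q 1)) (trans (+-suc p q) (cong suc (+-comm p q))) ⟩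
  suc (q + p) ∎

countE-corner : ∀ a b → countE (corner a b) ≡ b
countE-corner a b = trans (countE-++ (replicate a N) _) (cong₂ _+_ (countE-Nⁿ a) (countE-Eⁿ b))

countN-corner : ∀ a b → countN (corner a b) ≡ a
countN-corner a b = trans (countN-++ (replicate a N) _) (trans (cong₂ _+_ (countN-Nⁿ a) (countN-Eⁿ b)) (+-identityʳ a))

toPath-isNuPath : ∀ A B (c : NuPath A B) → IsNuPath (nu (suc A) (suc B)) (toPath c)
toPath-isNuPath A B (below p q r s q+p≡A r+s≡B) = isNuPath-intro A B (zigzag p (suc q) r s)
  (trans (countE-zigzag p (suc q) r s) (cong suc r+s≡B)) (trans (countN-zigzag p (suc q) r s) (cong suc q+p≡A)) (Above-zigzag A B p (suc q) r s q+p≡A r+s≡B)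
toPath-isNuPath A B (at r s r+s≡B) = isNuPath-intro A B (zigzag A 0 r s)
  (trans (countE-zigzag A 0 r s) (cong suc r+s≡B)) (countN-zigzag A 0 r s) (Above-zigzag A B A 0 r s refl r+s≡B)
toPath-isNuPath A B top = isNuPath-intro A B (corner (suc A) (suc B)) (countE-corner (suc A) (suc B)) (countN-corner (suc A) (suc B)) (Above-corner A B)

leadingN : ∀ μ → Σ[ p ∈ ℕ ] Σ[ rest ∈ Path ] μ ≡ replicate p N ++ rest × (rest ≡ [] ⊎ Σ[ t ∈ Path ] rest ≡ E ∷ t)
leadingN []      = 0 , [] , refl , inj₁ refl
leadingN (E ∷ μ) = 0 , E ∷ μ , refl , inj₂ (μ , refl)
leadingN (N ∷ μ) with leadingN μ
... | p , rest , μ≡ , rest-shape = suc p , rest , cong (N ∷_) μ≡ , rest-shape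

countN≡0⇒Eⁿ : ∀ t → countN t ≡ 0 → t ≡ replicate (countE t) E
countN≡0⇒Eⁿ []      _  = refl
countN≡0⇒Eⁿ (E ∷ t) eq = cong (E ∷_) (countN≡0⇒Eⁿ t eq)

countN≡1⇒EʲNEᵐ : ∀ t → countN t ≡ 1 → Σ[ j ∈ ℕ ] Σ[ m ∈ ℕ ] t ≡ replicate j E ++ N ∷ replicate m E
countN≡1⇒EʲNEᵐ (E ∷ t) eq with countN≡1⇒EʲNEᵐ t eq
... | j , m , t≡ = suc j , m , cong (E ∷_) t≡
countN≡1⇒EʲNEᵐ (N ∷ t) eq = 0 , countE t , cong (N ∷_) (countN≡0⇒Eⁿ t (suc-injective eq))

counts-NᵖENᵠ : ∀ p q t → countE (replicate p N ++ E ∷ replicate q N ++ t) ≡ suc (countE t) × countN (replicate p N ++ E ∷ replicate q N ++ t) ≡ p + (q + countN t)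
counts-NᵖENᵠ p q t =
  trans (countE-++ (replicate p N) _) (cong₂ (λ m n → m + suc n) (countE-Nⁿ p) (trans (countE-++ (replicate q N) t) (cong (_+ countE t) (countE-Nⁿ q)))) ,
  trans (countN-++ (replicate p N) _) (cong₂ (λ m n → m + n) (countN-Nⁿ p) (trans (countN-++ (replicate q N) t) (cong (_+ countN t) (countN-Nⁿ q))))

-- the point reached by the second east step is (2 , q + p)
second-E-height : ∀ A B p q t → All (Above A B) (points (replicate p N ++ E ∷ replicate q N ++ E ∷ t)) → A ≤ q + p
second-E-height A B p q t above
  with ++⁻ʳ ((0 , 0) ∷ pointsFrom 0 0 (replicate p N) ++ (1 , p + 0) ∷ pointsFrom 1 (p + 0) (replicate q N)) (subst (All (Above A B)) points≡ above)
  where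
  points≡ : points (replicate p N ++ E ∷ replicate q N ++ E ∷ t) ≡
    ((0 , 0) ∷ pointsFrom 0 0 (replicate p N) ++ (1 , p + 0) ∷ pointsFrom 1 (p + 0) (replicate q N)) ++ (2 , q + (p + 0)) ∷ pointsFrom 2 (q + (p + 0)) t
  points≡ = cong ((0 , 0) ∷_) (trans (pointsFrom-Nⁿ-++ 0 0 p _)
    (trans (cong (λ ps → pointsFrom 0 0 (replicate p N) ++ (1 , p + 0) ∷ ps) (pointsFrom-Nⁿ-++ 1 (p + 0) q (E ∷ t))) (sym (++-assoc (pointsFrom 0 0 (replicate p N)) _ _))))
... | inj₁ (s≤s ()) ∷ _
... | inj₂ (_ , A≤) ∷ _ = subst (A ≤_) (cong (q +_) (+-identityʳ p)) A≤

private
  +-shuffle : ∀ p q n → p + (q + n) ≡ n + (q + p)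
  +-shuffle = solve-∀

classify-zigzag : ∀ A B p q r s → q + p ≡ A → r + s ≡ B → Σ (NuPath A B) λ c → zigzag p q r s ≡ toPath c
classify-zigzag A B p zero    r s p≡A     r+s≡B = at r s r+s≡B , cong (λ a → zigzag a 0 r s) p≡A
classify-zigzag A B p (suc q) r s q+1+p≡A r+s≡B = below p q r s q+1+p≡A r+s≡B , refl

classify-one-E : ∀ A B p q → countE (replicate p N ++ E ∷ replicate q N ++ []) ≡ suc B → countN (replicate p N ++ E ∷ replicate q N ++ []) ≡ suc A →
  Σ (NuPath A B) λ c → replicate p N ++ E ∷ replicate q N ++ [] ≡ toPath c
classify-one-E A B p q countE≡ countN≡ with suc-injective (trans (sym (proj₁ (counts-NᵖENᵠ p q []))) countE≡)
... | refl with q | trans (sym (proj₂ (counts-NᵖENᵠ p q []))) countN≡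
...   | zero   | p+0≡ = top , cong (λ a → replicate a N ++ E ∷ []) (trans (sym (+-identityʳ p)) p+0≡)
...   | suc q′ | p+q≡ = map₂ (trans (cong (λ w → replicate p N ++ E ∷ w) Nᵠ≡)) (classify-zigzag A 0 p q′ 0 0 q′+p≡A refl)
  where
  q′+p≡A : q′ + p ≡ A
  q′+p≡A = suc-injective (trans (cong suc (+-comm q′ p)) (trans (sym (+-suc p q′)) (trans (cong (p +_) (sym (+-identityʳ (suc q′)))) p+q≡)))
  Nᵠ≡ : replicate (suc q′) N ++ [] ≡ replicate q′ N ++ N ∷ []
  Nᵠ≡ = trans (++-identityʳ _) (sym (replicate-∷ʳ q′ N))

classify-flat-tail : ∀ A p q t → countN t ≡ 0 → countN t + (q + p) ≡ suc A →
  Σ (NuPath A (suc (countE t))) λ c → replicate p N ++ E ∷ replicate q N ++ E ∷ t ≡ toPath c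
classify-flat-tail A p zero t t-flat n+p≡ =
  top , cong₂ (λ a w → replicate a N ++ E ∷ E ∷ w) (trans (cong (_+ p) (sym t-flat)) n+p≡) (countN≡0⇒Eⁿ t t-flat)
classify-flat-tail A p (suc q) t t-flat n+q+p≡ = map₂ (trans (cong (λ w → replicate p N ++ E ∷ w) path≡)) (classify-zigzag A _ p q 0 (suc (countE t)) q+p≡A refl)
  where
  q+p≡A : q + p ≡ A
  q+p≡A = suc-injective (trans (cong (_+ suc (q + p)) (sym t-flat)) n+q+p≡)
  path≡ : replicate (suc q) N ++ E ∷ t ≡ replicate q N ++ N ∷ E ∷ replicate (countE t) E
  path≡ = trans (sym (replicate-++-∷ q N (E ∷ t))) (cong (λ w → replicate q N ++ N ∷ E ∷ w) (countN≡0⇒Eⁿ t t-flat))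

classify-two-E : ∀ A B p q t → countE (replicate p N ++ E ∷ replicate q N ++ E ∷ t) ≡ suc B → countN (replicate p N ++ E ∷ replicate q N ++ E ∷ t) ≡ suc A →
  A ≤ q + p → Σ (NuPath A B) λ c → replicate p N ++ E ∷ replicate q N ++ E ∷ t ≡ toPath c
classify-two-E A B p q t countE≡ countN≡ A≤q+p with suc-injective (trans (sym (proj₁ (counts-NᵖENᵠ p q (E ∷ t)))) countE≡)
... | refl = by-countN (countN t) refl
  where
  countN-t+q+p : countN t + (q + p) ≡ suc A
  countN-t+q+p = trans (sym (+-shuffle p q (countN t))) (trans (sym (proj₂ (counts-NᵖENᵠ p q (E ∷ t)))) countN≡)
  by-countN : ∀ n → countN t ≡ n → Σ (NuPath A (suc (countE t))) λ c → replicate p N ++ E ∷ replicate q N ++ E ∷ t ≡ toPath c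
  by-countN zero t-flat = classify-flat-tail A p q t t-flat countN-t+q+p
  by-countN (suc zero) t-one with countN≡1⇒EʲNEᵐ t t-one
  ... | j , m , refl = classify-zigzag A _ p q (suc j) m q+p≡A (cong suc (sym (trans (countE-++ (replicate j E) _) (cong₂ _+_ (countE-Eⁿ j) (countE-Eⁿ m)))))
    where
    q+p≡A : q + p ≡ A
    q+p≡A = suc-injective (trans (cong (_+ (q + p)) (sym t-one)) countN-t+q+p)
  by-countN (suc (suc n)) t-two = ⊥-elim (<-irrefl refl (<-≤-trans A< A≤q+p))
    where
    A< : q + p < A
    A< = subst (q + p <_) (suc-injective (trans (cong (_+ (q + p)) (sym t-two)) countN-t+q+p)) (s≤s (m≤n+m (q + p) n))

classify : ∀ A B μ → IsNuPath (nu (suc A) (suc B)) μ → Σ (NuPath A B) λ c → μ ≡ toPath c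
classify A B μ isNu with isNuPath-elim A B μ isNu
... | countE≡ , countN≡ , above with leadingN μ
... | p , _ , refl , inj₁ refl = ⊥-elim (0≢1+n (trans (sym (trans (countE-++ (replicate p N) []) (cong (_+ 0) (countE-Nⁿ p)))) countE≡))
... | p , _ , refl , inj₂ (t , refl) with leadingN t
...   | q , _ , refl , inj₁ refl          = classify-one-E A B p q countE≡ countN≡
...   | q , _ , refl , inj₂ (t₂ , refl)   = classify-two-E A B p q t₂ countE≡ countN≡ (second-E-height A B p q t₂ above)

rise : (ℕ → ℕ) → ℕ → Path → ℕ
rise δ c []      = 0
rise δ c (E ∷ p) = rise δ c p
rise δ c (N ∷ p) = δ (suc c) + rise δ (suc c) p

altFrom+countE≡rise : ∀ δ c p → altFrom δ c p +ℤ ℤ.+ countE p ≡ ℤ.+ rise δ c p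
altFrom+countE≡rise δ c []      = refl
altFrom+countE≡rise δ c (E ∷ p) = begin
  (-[1+ 0 ] +ℤ altFrom δ c p) +ℤ ℤ.+ suc (countE p) ≡⟨ cong (_+ℤ ℤ.+ suc (countE p)) (ℤ.+-comm -[1+ 0 ] (altFrom δ c p)) ⟩
  (altFrom δ c p +ℤ -[1+ 0 ]) +ℤ ℤ.+ suc (countE p) ≡⟨ ℤ.+-assoc (altFrom δ c p) -[1+ 0 ] (ℤ.+ suc (countE p)) ⟩
  altFrom δ c p +ℤ ℤ.+ countE p                     ≡⟨ altFrom+countE≡rise δ c p ⟩
  ℤ.+ rise δ c p                                     ∎
altFrom+countE≡rise δ c (N ∷ p) = begin
  (ℤ.+ δ (suc c) +ℤ altFrom δ (suc c) p) +ℤ ℤ.+ countE p ≡⟨ ℤ.+-assoc (ℤ.+ δ (suc c)) (altFrom δ (suc c) p) (ℤ.+ countE p) ⟩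
  ℤ.+ δ (suc c) +ℤ (altFrom δ (suc c) p +ℤ ℤ.+ countE p) ≡⟨ cong (ℤ.+ δ (suc c) +ℤ_) (altFrom+countE≡rise δ (suc c) p) ⟩
  ℤ.+ (δ (suc c) + rise δ (suc c) p)                    ∎

altFrom-++ : ∀ δ c xs ys → altFrom δ c (xs ++ ys) ≡ altFrom δ c xs +ℤ altFrom δ (countN xs + c) ys
altFrom-++ δ c []       ys = sym (ℤ.+-identityˡ _)
altFrom-++ δ c (E ∷ xs) ys = trans (cong (-[1+ 0 ] +ℤ_) (altFrom-++ δ c xs ys)) (sym (ℤ.+-assoc -[1+ 0 ] (altFrom δ c xs) _))
altFrom-++ δ c (N ∷ xs) ys =
  trans (cong (ℤ.+ δ (suc c) +ℤ_) (trans (altFrom-++ δ (suc c) xs ys) (cong (λ n → altFrom δ (suc c) xs +ℤ altFrom δ n ys) (+-suc (countN xs) c))))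
        (sym (ℤ.+-assoc (ℤ.+ δ (suc c)) (altFrom δ (suc c) xs) _))

alt-++E++ : ∀ δ u w → alt δ (u ++ E ∷ w) ≡ alt δ (u ++ E ∷ []) +ℤ altFrom δ (countN u) w
alt-++E++ δ u w = begin
  alt δ (u ++ E ∷ w)                                                ≡⟨ cong (altFrom δ 0) (sym (++-assoc u (E ∷ []) w)) ⟩
  altFrom δ 0 ((u ++ E ∷ []) ++ w)                                  ≡⟨ altFrom-++ δ 0 (u ++ E ∷ []) w ⟩
  alt δ (u ++ E ∷ []) +ℤ altFrom δ (countN (u ++ E ∷ []) + 0) w     ≡⟨ cong (λ n → alt δ (u ++ E ∷ []) +ℤ altFrom δ n w) countN-u-E ⟩
  alt δ (u ++ E ∷ []) +ℤ altFrom δ (countN u) w                     ∎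
  where countN-u-E = trans (+-identityʳ _) (trans (countN-++ u (E ∷ [])) (+-identityʳ (countN u)))

returns⇒balanced : ∀ δ u w → alt δ (u ++ E ∷ w) ≡ alt δ (u ++ E ∷ []) → rise δ (countN u) w ≡ countE w
returns⇒balanced δ u w alt≡ = ℤ.+-injective (begin
  ℤ.+ rise δ (countN u) w                  ≡⟨ sym (altFrom+countE≡rise δ (countN u) w) ⟩
  altFrom δ (countN u) w +ℤ ℤ.+ countE w   ≡⟨ cong (_+ℤ ℤ.+ countE w) altFrom≡0 ⟩
  ℤ.+ 0 +ℤ ℤ.+ countE w                      ≡⟨ ℤ.+-identityˡ _ ⟩
  ℤ.+ countE w                             ∎)
  where altFrom≡0 = identityʳ-unique (alt δ (u ++ E ∷ [])) (altFrom δ (countN u) w) (trans (sym (alt-++E++ δ u w)) alt≡)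

balanced⇒returns : ∀ δ u w → rise δ (countN u) w ≡ countE w → alt δ (u ++ E ∷ w) ≡ alt δ (u ++ E ∷ [])
balanced⇒returns δ u w balanced = begin
  alt δ (u ++ E ∷ w)                              ≡⟨ alt-++E++ δ u w ⟩
  alt δ (u ++ E ∷ []) +ℤ altFrom δ (countN u) w   ≡⟨ cong (alt δ (u ++ E ∷ []) +ℤ_) altFrom≡0 ⟩
  alt δ (u ++ E ∷ []) +ℤ ℤ.+ 0                      ≡⟨ ℤ.+-identityʳ _ ⟩
  alt δ (u ++ E ∷ [])                             ∎
  where altFrom≡0 = identityˡ-unique (altFrom δ (countN u) w) (ℤ.+ countE w) (trans (altFrom+countE≡rise δ (countN u) w) (cong ℤ.+_ balanced))

δ-first≤rise : ∀ δ c w → δ (suc c) ≤ rise δ c (N ∷ w)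
δ-first≤rise δ c w = m≤m+n (δ (suc c)) (rise δ (suc c) w)

countE-proper-prefix : ∀ x w₁ w₂ → x ++ E ∷ [] ≡ w₁ ++ w₂ → w₂ ≢ [] → countE w₁ < countE (x ++ E ∷ [])
countE-proper-prefix []      []       w₂ _  _   = s≤s z≤n
countE-proper-prefix []      (_ ∷ w₁) w₂ eq w₂≢[] with w₁ | w₂ | proj₂ (∷-injective eq)
... | [] | [] | _ = ⊥-elim (w₂≢[] refl)
countE-proper-prefix (y ∷ x) []       w₂ _  _   = ≤-trans (s≤s z≤n) (≤-reflexive (sym (countE-last (y ∷ x))))
  where
  countE-last : ∀ x → countE (x ++ E ∷ []) ≡ suc (countE x)
  countE-last x = trans (countE-++ x (E ∷ [])) (+-comm (countE x) 1)
countE-proper-prefix (y ∷ x) (z ∷ w₁) w₂ eq w₂≢[] with ∷-injective eq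
countE-proper-prefix (E ∷ x) (E ∷ w₁) w₂ eq w₂≢[] | refl , eq′ = s≤s (countE-proper-prefix x w₁ w₂ eq′ w₂≢[])
countE-proper-prefix (N ∷ x) (N ∷ w₁) w₂ eq w₂≢[] | refl , eq′ = countE-proper-prefix x w₁ w₂ eq′ w₂≢[]

-- If the first N step of w alone rises by at least the number of E steps of w, no proper prefix of w
-- is balanced, so a balanced w is the first return to the altitude of the valley.
rot-intro : ∀ δ μ μ′ u w₀ v → μ ≡ u ++ E ∷ (N ∷ w₀) ++ v → μ′ ≡ u ++ (N ∷ w₀) ++ E ∷ v →
  (w₀ ≡ [] ⊎ Σ[ x ∈ Path ] N ∷ w₀ ≡ x ++ E ∷ []) →
  countE (N ∷ w₀) ≤ δ (suc (countN u)) → rise δ (countN u) (N ∷ w₀) ≡ countE (N ∷ w₀) → Rot δ μ μ′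
rot-intro δ μ μ′ u w₀ v μ≡ μ′≡ w-shape countE≤ balanced =
  u , N ∷ w₀ , v , μ≡ , (w₀ , refl) , balanced⇒returns δ u (N ∷ w₀) balanced , first-return , μ′≡
  where
  first-return : ∀ w₁ w₂ → N ∷ w₀ ≡ w₁ ++ w₂ → w₁ ≢ [] → w₂ ≢ [] → alt δ (u ++ E ∷ w₁) ≢ alt δ (u ++ E ∷ [])
  first-return []       w₂ _  w₁≢[] _     _     = w₁≢[] refl
  first-return (y ∷ w₁) w₂ eq _     w₂≢[] alt≡ with ∷-injective eq
  ... | refl , w₀≡ = <-irrefl (sym (returns⇒balanced δ u (N ∷ w₁) alt≡))
        (<-≤-trans (countE-w₁< w-shape) (≤-trans countE≤ (δ-first≤rise δ (countN u) w₁)))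
    where
    countE-w₁< : (w₀ ≡ [] ⊎ Σ[ x ∈ Path ] N ∷ w₀ ≡ x ++ E ∷ []) → countE (N ∷ w₁) < countE (N ∷ w₀)
    countE-w₁< (inj₁ refl) = ⊥-elim (w₂≢[] (++-conicalʳ w₁ w₂ (sym w₀≡)))
    countE-w₁< (inj₂ (x , x≡)) =
      subst (λ w → countE (N ∷ w₁) < countE w) (sym x≡) (countE-proper-prefix x (N ∷ w₁) w₂ (trans (sym x≡) (cong (N ∷_) w₀≡)) w₂≢[])

leadN : Path → ℕ
leadN (N ∷ p) = suc (leadN p)
leadN _       = 0

leadE : Path → ℕ
leadE (E ∷ p) = suc (leadE p)
leadE _       = 0

trailE : Path → ℕ
trailE p = leadE (reverse p)

leadN-moveE : ∀ u w v → leadN (u ++ E ∷ w ++ v) ≤ leadN (u ++ w ++ E ∷ v)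
leadN-moveE []      w v = z≤n
leadN-moveE (N ∷ u) w v = s≤s (leadN-moveE u w v)
leadN-moveE (E ∷ u) w v = z≤n

leadE-moveE : ∀ x y z → leadE (x ++ y ++ E ∷ z) ≤ leadE (x ++ E ∷ y ++ z)
leadE-moveE []      y z = leadE-insert y z
  where
  leadE-insert : ∀ y z → leadE (y ++ E ∷ z) ≤ suc (leadE (y ++ z))
  leadE-insert []      z = ≤-refl
  leadE-insert (E ∷ y) z = s≤s (leadE-insert y z)
  leadE-insert (N ∷ y) z = z≤n
leadE-moveE (E ∷ x) y z = s≤s (leadE-moveE x y z)
leadE-moveE (N ∷ x) y z = z≤n

trailE-moveE : ∀ u w v → trailE (u ++ E ∷ w ++ v) ≤ trailE (u ++ w ++ E ∷ v)
trailE-moveE u w v = subst₂ _≤_ (cong leadE (sym reverse-μ)) (cong leadE (sym reverse-μ′)) (leadE-moveE (reverse v) (reverse w) (reverse u))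
  where
  reverse-μ : reverse (u ++ E ∷ w ++ v) ≡ reverse v ++ reverse w ++ E ∷ reverse u
  reverse-μ = begin
    reverse (u ++ E ∷ w ++ v)                   ≡⟨ reverse-++ u (E ∷ w ++ v) ⟩
    reverse (E ∷ w ++ v) ++ reverse u           ≡⟨ cong (_++ reverse u) (unfold-reverse E (w ++ v)) ⟩
    (reverse (w ++ v) ++ E ∷ []) ++ reverse u   ≡⟨ ++-assoc (reverse (w ++ v)) (E ∷ []) (reverse u) ⟩
    reverse (w ++ v) ++ E ∷ reverse u           ≡⟨ cong (_++ E ∷ reverse u) (reverse-++ w v) ⟩
    (reverse v ++ reverse w) ++ E ∷ reverse u   ≡⟨ ++-assoc (reverse v) (reverse w) (E ∷ reverse u) ⟩
    reverse v ++ reverse w ++ E ∷ reverse u     ∎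
  reverse-μ′ : reverse (u ++ w ++ E ∷ v) ≡ reverse v ++ E ∷ reverse w ++ reverse u
  reverse-μ′ = begin
    reverse (u ++ w ++ E ∷ v)                    ≡⟨ reverse-++ u (w ++ E ∷ v) ⟩
    reverse (w ++ E ∷ v) ++ reverse u            ≡⟨ cong (_++ reverse u) (reverse-++ w (E ∷ v)) ⟩
    (reverse (E ∷ v) ++ reverse w) ++ reverse u  ≡⟨ cong (λ r → (r ++ reverse w) ++ reverse u) (unfold-reverse E v) ⟩
    ((reverse v ++ E ∷ []) ++ reverse w) ++ reverse u ≡⟨ cong (_++ reverse u) (++-assoc (reverse v) (E ∷ []) (reverse w)) ⟩
    (reverse v ++ E ∷ reverse w) ++ reverse u    ≡⟨ ++-assoc (reverse v) (E ∷ reverse w) (reverse u) ⟩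
    reverse v ++ E ∷ reverse w ++ reverse u      ∎

rot-leadN-trailE : ∀ δ μ μ′ → Rot δ μ μ′ → leadN μ ≤ leadN μ′ × trailE μ ≤ trailE μ′
rot-leadN-trailE δ μ μ′ (u , w , v , refl , _ , _ , _ , refl) = leadN-moveE u w v , trailE-moveE u w v

leadN-Nᵃ-++-E : ∀ a w → leadN (replicate a N ++ E ∷ w) ≡ a
leadN-Nᵃ-++-E zero    w = refl
leadN-Nᵃ-++-E (suc a) w = cong suc (leadN-Nᵃ-++-E a w)

trailE-++-N-Eᵇ : ∀ w b → trailE (w ++ N ∷ replicate b E) ≡ b
trailE-++-N-Eᵇ w b = begin
  leadE (reverse (w ++ N ∷ replicate b E))               ≡⟨ cong leadE (reverse-++ w (N ∷ replicate b E)) ⟩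
  leadE (reverse (N ∷ replicate b E) ++ reverse w)       ≡⟨ cong (λ r → leadE (r ++ reverse w)) (unfold-reverse N (replicate b E)) ⟩
  leadE ((reverse (replicate b E) ++ N ∷ []) ++ reverse w) ≡⟨ cong (λ r → leadE ((r ++ N ∷ []) ++ reverse w)) (reverse-replicate b E) ⟩
  leadE ((replicate b E ++ N ∷ []) ++ reverse w)         ≡⟨ cong leadE (++-assoc (replicate b E) (N ∷ []) (reverse w)) ⟩
  leadE (replicate b E ++ N ∷ reverse w)                 ≡⟨ leadE-Eᵇ-++-N b (reverse w) ⟩
  b                                                      ∎
  where
  leadE-Eᵇ-++-N : ∀ b w → leadE (replicate b E ++ N ∷ w) ≡ b
  leadE-Eᵇ-++-N zero    w = refl
  leadE-Eᵇ-++-N (suc b) w = cong suc (leadE-Eᵇ-++-N b w)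

δ-A : ∀ A k → deltaK (suc A) k A ≡ k
δ-A A k = cong (λ b → if b then k else 0) (≡ᵇ-refl A)

δ-≢A : ∀ A k i → i ≢ A → deltaK (suc A) k i ≡ 0
δ-≢A A k i i≢A = cong (λ b → if b then k else 0) (≢⇒≡ᵇ≡false i≢A)

rise-Eⁿ : ∀ δ c n → rise δ c (replicate n E) ≡ 0
rise-Eⁿ δ c zero    = refl
rise-Eⁿ δ c (suc n) = rise-Eⁿ δ c n

++-Eⁿ⁺¹ : ∀ x n → x ++ replicate (suc n) E ≡ (x ++ replicate n E) ++ E ∷ []
++-Eⁿ⁺¹ x n = trans (cong (x ++_) (sym (replicate-∷ʳ n E))) (sym (++-assoc x (replicate n E) (E ∷ [])))

rot-shiftE : ∀ A k p q r s → q + p ≡ A → Rot (deltaK (suc A) k) (zigzag p q (suc r) s) (zigzag p q r (suc s))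
rot-shiftE A k p q r s q+p≡A = rot-intro _ _ _ u [] (replicate s E) μ≡ μ′≡ (inj₁ refl) z≤n
  (trans (+-identityʳ _) (δ-≢A A k _ (λ eq → <-irrefl (sym (trans (sym countN-u+1) eq)) (n<1+n A))))
  where
  u = replicate p N ++ E ∷ replicate q N ++ replicate r E
  countN-u+1 : suc (countN u) ≡ suc A
  countN-u+1 = cong suc (trans (countN-++ (replicate p N) _) (trans (cong₂ _+_ (countN-Nⁿ p) (trans (countN-++ (replicate q N) _) (cong₂ _+_ (countN-Nⁿ q) (countN-Eⁿ r))))
    (trans (cong (p +_) (+-identityʳ q)) (trans (+-comm p q) q+p≡A))))
  μ≡ : zigzag p q (suc r) s ≡ u ++ E ∷ N ∷ replicate s E
  μ≡ = sym (trans (++-assoc (replicate p N) _ _) (cong (λ w → replicate p N ++ E ∷ w)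
         (trans (++-assoc (replicate q N) _ _) (cong (replicate q N ++_) (replicate-++-∷ r E _)))))
  μ′≡ : zigzag p q r (suc s) ≡ u ++ N ∷ E ∷ replicate s E
  μ′≡ = sym (trans (++-assoc (replicate p N) _ _) (cong (λ w → replicate p N ++ E ∷ w) (++-assoc (replicate q N) _ _)))

rot-firstN : ∀ A k p q r s → suc (suc q) + p ≡ A → Rot (deltaK (suc A) k) (zigzag p (suc (suc q)) r s) (zigzag (suc p) (suc q) r s)
rot-firstN A k p q r s q+2+p≡A = rot-intro _ _ _ (replicate p N) [] v refl (sym (replicate-++-∷ p N (E ∷ v))) (inj₁ refl) z≤n
  (trans (+-identityʳ _) (δ-≢A A k _ (λ eq → <-irrefl (trans (sym (cong suc (countN-Nⁿ p))) eq) p+1<A)))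
  where
  v = replicate (suc q) N ++ replicate r E ++ N ∷ replicate s E
  p+1<A : suc p < A
  p+1<A = subst (suc p <_) q+2+p≡A (s≤s (s≤s (m≤n+m p q)))

rot-at-top : ∀ A k B → Rot (deltaK (suc A) k) (zigzag A 0 0 B) (corner (suc A) (suc B))
rot-at-top A k B = rot-intro _ _ _ (replicate A N) [] (replicate B E) refl (sym (replicate-++-∷ A N (E ∷ replicate B E))) (inj₁ refl) z≤n
  (trans (+-identityʳ _) (δ-≢A A k _ (λ eq → <-irrefl (sym (trans (sym (cong suc (countN-Nⁿ A))) eq)) (n<1+n A))))

δ-first : ∀ k p → deltaK (suc (suc p)) k (suc (countN (replicate p N))) ≡ k
δ-first k p = trans (cong (λ c → deltaK (suc (suc p)) k (suc c)) (countN-Nⁿ p)) (δ-A (suc p) k)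

δ-after-first : ∀ k p → deltaK (suc (suc p)) k (suc (suc p)) ≡ 0
δ-after-first k p = δ-≢A (suc p) k (suc (suc p)) (λ eq → <-irrefl (sym eq) (n<1+n (suc p)))

rot-to-at : ∀ A k p r s → suc p ≡ A → k ≤ r → Rot (deltaK (suc A) k) (zigzag p 1 r s) (zigzag A 0 r s)
rot-to-at .(suc p) k p r s refl k≤r with m≤n⇒∃[o]m+o≡n k≤r
... | e , refl = rot-intro _ _ _ (replicate p N) (replicate k E) v μ≡ μ′≡ (w-shape k)
  (≤-reflexive (trans (countE-Eⁿ k) (sym (δ-first k p))))
  (trans (cong₂ _+_ (δ-first k p) (rise-Eⁿ _ (suc (countN (replicate p N))) k)) (trans (+-identityʳ k) (sym (countE-Eⁿ k))))
  where
  v = replicate e E ++ N ∷ replicate s E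
  Eᵏ⁺ᵉ : replicate (k + e) E ++ N ∷ replicate s E ≡ replicate k E ++ v
  Eᵏ⁺ᵉ = trans (cong (_++ N ∷ replicate s E) (replicate-+ k e E)) (++-assoc (replicate k E) (replicate e E) _)
  μ≡ : zigzag p 1 (k + e) s ≡ replicate p N ++ E ∷ (N ∷ replicate k E) ++ v
  μ≡ = cong (λ w → replicate p N ++ E ∷ N ∷ w) Eᵏ⁺ᵉ
  μ′≡ : zigzag (suc p) 0 (k + e) s ≡ replicate p N ++ (N ∷ replicate k E) ++ E ∷ v
  μ′≡ = sym (trans (replicate-++-∷ p N _) (cong (λ w → N ∷ replicate p N ++ w) (trans (replicate-++-∷ k E v) (cong (E ∷_) (sym Eᵏ⁺ᵉ)))))
  w-shape : ∀ k → replicate k E ≡ [] ⊎ Σ[ x ∈ Path ] N ∷ replicate k E ≡ x ++ E ∷ []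
  w-shape zero    = inj₁ refl
  w-shape (suc k) = inj₂ (N ∷ replicate k E , ++-Eⁿ⁺¹ (N ∷ []) k)

rise-Eⁿ-++ : ∀ δ c n w → rise δ c (replicate n E ++ w) ≡ rise δ c w
rise-Eⁿ-++ δ c zero    w = refl
rise-Eⁿ-++ δ c (suc n) w = rise-Eⁿ-++ δ c n w

rise-after-Nᵖ : ∀ δ p w → rise δ (countN (replicate p N)) w ≡ rise δ p w
rise-after-Nᵖ δ p w = cong (λ c → rise δ c w) (countN-Nⁿ p)

rot-past-A : ∀ A k p r s → suc p ≡ A → suc r < k → k ≤ suc r + s → Rot (deltaK (suc A) k) (zigzag p 1 (suc r) s) (zigzag A 0 r (suc s))
rot-past-A .(suc p) k p r s refl r+1<k k≤ with m≤n⇒∃[o]m+o≡n r+1<k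
... | m , refl with m≤n⇒∃[o]m+o≡n (+-cancelˡ-≤ (suc r) (suc m) s (subst (_≤ suc r + s) (sym (+-suc (suc r) m)) k≤))
... | n , refl = rot-intro _ _ _ (replicate p N) w₀ (replicate n E) μ≡ μ′≡ (inj₂ (N ∷ replicate (suc r) E ++ N ∷ replicate m E , ends))
  (≤-reflexive (trans countE-w (sym (δ-first k p))))
  (trans (rise-after-Nᵖ δ p (N ∷ w₀)) (trans rise-w (sym countE-w)))
  where
  δ = deltaK (suc (suc p)) k
  w₀ = replicate (suc r) E ++ N ∷ replicate (suc m) E
  ends : N ∷ w₀ ≡ (N ∷ replicate (suc r) E ++ N ∷ replicate m E) ++ E ∷ []
  ends = cong (N ∷_) (trans (cong (λ w → replicate (suc r) E ++ N ∷ w) (sym (replicate-∷ʳ m E))) (sym (++-assoc (replicate (suc r) E) (N ∷ replicate m E) (E ∷ []))))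
  countE-w : countE (N ∷ w₀) ≡ k
  countE-w = trans (countE-++ (replicate (suc r) E) _) (trans (cong₂ _+_ (countE-Eⁿ (suc r)) (countE-Eⁿ (suc m))) (+-suc (suc r) m))
  rise-w : rise δ p (N ∷ w₀) ≡ k
  rise-w = begin
    δ (suc p) + rise δ (suc p) (replicate (suc r) E ++ N ∷ replicate (suc m) E)
      ≡⟨ cong₂ _+_ (δ-A (suc p) k) (rise-Eⁿ-++ δ (suc p) (suc r) _) ⟩
    k + (δ (suc (suc p)) + rise δ (suc (suc p)) (replicate (suc m) E))
      ≡⟨ cong₂ (λ a b → k + (a + b)) (δ-after-first k p) (rise-Eⁿ δ _ (suc m)) ⟩
    k + 0
      ≡⟨ +-identityʳ k ⟩
    k ∎
  μ≡ : zigzag p 1 (suc r) (suc m + n) ≡ replicate p N ++ E ∷ (N ∷ w₀) ++ replicate n E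
  μ≡ = cong (λ w → replicate p N ++ E ∷ N ∷ w) (sym (trans (++-assoc (replicate (suc r) E) (N ∷ replicate (suc m) E) (replicate n E))
         (cong (λ z → replicate (suc r) E ++ N ∷ z) (sym (replicate-+ (suc m) n E)))))
  μ′≡ : zigzag (suc p) 0 r (suc (suc m + n)) ≡ replicate p N ++ (N ∷ w₀) ++ E ∷ replicate n E
  μ′≡ = sym (begin
    replicate p N ++ N ∷ (replicate (suc r) E ++ N ∷ replicate (suc m) E) ++ E ∷ replicate n E
      ≡⟨ replicate-++-∷ p N _ ⟩
    N ∷ replicate p N ++ (E ∷ replicate r E ++ N ∷ replicate (suc m) E) ++ E ∷ replicate n E
      ≡⟨ cong (λ w → N ∷ replicate p N ++ E ∷ w) (++-assoc (replicate r E) _ _) ⟩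
    N ∷ replicate p N ++ E ∷ replicate r E ++ N ∷ replicate (suc m) E ++ E ∷ replicate n E
      ≡⟨ cong (λ w → N ∷ replicate p N ++ E ∷ replicate r E ++ N ∷ w) (trans (replicate-++-∷ (suc m) E _) (cong (E ∷_) (sym (replicate-+ (suc m) n E)))) ⟩
    N ∷ replicate p N ++ E ∷ replicate r E ++ N ∷ E ∷ replicate (suc m + n) E ∎)

rot-to-top : ∀ A k p B → suc p ≡ A → 1 ≤ k → k ≤ B → Rot (deltaK (suc A) k) (zigzag p 1 0 B) (corner (suc A) (suc B))
rot-to-top .(suc p) (suc k) p B refl _ k≤B with m≤n⇒∃[o]m+o≡n k≤B
... | e , refl = rot-intro _ _ _ (replicate p N) w₀ (replicate e E) μ≡ μ′≡ (inj₂ (N ∷ N ∷ replicate k E , ++-Eⁿ⁺¹ (N ∷ N ∷ []) k))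
  (≤-reflexive (trans (countE-Eⁿ (suc k)) (sym (δ-first (suc k) p))))
  (trans (rise-after-Nᵖ δ p (N ∷ w₀)) (trans rise-w (sym (countE-Eⁿ (suc k)))))
  where
  δ = deltaK (suc (suc p)) (suc k)
  w₀ = N ∷ replicate (suc k) E
  rise-w : rise δ p (N ∷ w₀) ≡ suc k
  rise-w = trans (cong₂ (λ a b → a + (b + rise δ (suc (suc p)) (replicate (suc k) E))) (δ-A (suc p) (suc k)) (δ-after-first (suc k) p))
             (trans (cong (λ b → suc k + b) (rise-Eⁿ δ _ (suc k))) (+-identityʳ (suc k)))
  μ≡ : zigzag p 1 0 (suc k + e) ≡ replicate p N ++ E ∷ (N ∷ w₀) ++ replicate e E
  μ≡ = cong (λ w → replicate p N ++ E ∷ N ∷ N ∷ w) (replicate-+ (suc k) e E)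
  μ′≡ : corner (suc (suc p)) (suc (suc k + e)) ≡ replicate p N ++ (N ∷ w₀) ++ E ∷ replicate e E
  μ′≡ = sym (begin
    replicate p N ++ N ∷ N ∷ replicate (suc k) E ++ E ∷ replicate e E
      ≡⟨ replicate-++-∷ p N _ ⟩
    N ∷ replicate p N ++ N ∷ replicate (suc k) E ++ E ∷ replicate e E
      ≡⟨ cong (N ∷_) (replicate-++-∷ p N _) ⟩
    N ∷ N ∷ replicate p N ++ replicate (suc k) E ++ E ∷ replicate e E
      ≡⟨ cong (λ w → N ∷ N ∷ replicate p N ++ w) (trans (replicate-++-∷ (suc k) E _) (cong (E ∷_) (sym (replicate-+ (suc k) e E)))) ⟩
    N ∷ N ∷ replicate p N ++ E ∷ replicate (suc k + e) E ∎)

++E≡NᵖE : ∀ p u R T → u ++ E ∷ R ≡ replicate p N ++ E ∷ T → (u ≡ replicate p N × R ≡ T) ⊎ Σ[ u′ ∈ Path ] u ≡ replicate p N ++ E ∷ u′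
++E≡NᵖE zero    []      R T eq = inj₁ (refl , proj₂ (∷-injective eq))
++E≡NᵖE zero    (E ∷ u) R T eq = inj₂ (u , refl)
++E≡NᵖE (suc p) (N ∷ u) R T eq with ++E≡NᵖE p u R T (proj₂ (∷-injective eq))
... | inj₁ (u≡ , R≡)  = inj₁ (cong (N ∷_) u≡ , R≡)
... | inj₂ (u′ , u≡) = inj₂ (u′ , cong (N ∷_) u≡)

NᵖE≢Nᵖ⁺ᵐ⁺¹ : ∀ p m x y → replicate p N ++ E ∷ x ≢ replicate (p + suc m) N ++ y
NᵖE≢Nᵖ⁺ᵐ⁺¹ zero    m x y ()
NᵖE≢Nᵖ⁺ᵐ⁺¹ (suc p) m x y eq = NᵖE≢Nᵖ⁺ᵐ⁺¹ p m x y (proj₂ (∷-injective eq))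

Eʳ-prefix : ∀ r w′ v Z → w′ ++ E ∷ v ≡ replicate r E ++ N ∷ Z → E ∷ w′ ++ v ≡ replicate r E ++ N ∷ Z → Σ[ j ∈ ℕ ] j < r × w′ ≡ replicate j E
Eʳ-prefix zero    w′       v Z eq₁ ()
Eʳ-prefix (suc r) []       v Z eq₁ eq₂ = 0 , s≤s z≤n , refl
Eʳ-prefix (suc r) (x ∷ w′) v Z eq₁ eq₂ with ∷-injective eq₁
... | refl , eq₁′ with Eʳ-prefix r w′ v Z eq₁′ (proj₂ (∷-injective eq₂))
... | j , j<r , refl = suc j , s≤s j<r , refl

rise-Nⁿ⁺¹-to-A : ∀ A k c n w → c + suc n ≡ A → rise (deltaK (suc A) k) c (replicate (suc n) N ++ w) ≡ k + rise (deltaK (suc A) k) A w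
rise-Nⁿ⁺¹-to-A A k c zero    w c+1≡A = cong₂ _+_ (trans (cong (deltaK (suc A) k) c+1≡A′) (δ-A A k)) (cong (λ c′ → rise (deltaK (suc A) k) c′ w) c+1≡A′)
  where c+1≡A′ = trans (+-comm 1 c) c+1≡A
rise-Nⁿ⁺¹-to-A A k c (suc n) w c+n+2≡A =
  cong₂ _+_ (δ-≢A A k (suc c) (λ c+1≡A → <-irrefl c+1≡A c+1<A)) (rise-Nⁿ⁺¹-to-A A k (suc c) n w (trans (sym (+-suc c (suc n))) c+n+2≡A))
  where c+1<A = subst (suc c <_) c+n+2≡A (≤-trans (s≤s (s≤s (m≤m+n c n))) (≤-reflexive (sym (trans (+-suc c (suc n)) (cong suc (+-suc c n))))))

private
  no-rot-core : ∀ A k p q r s w v → suc q + p ≡ A → r < k →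
    w ++ v ≡ replicate (suc q) N ++ replicate r E ++ N ∷ replicate s E →
    replicate (suc q) N ++ E ∷ replicate r E ++ N ∷ replicate s E ≡ w ++ E ∷ v →
    alt (deltaK (suc A) k) (replicate p N ++ E ∷ w) ≡ alt (deltaK (suc A) k) (replicate p N ++ E ∷ []) → ⊥
  no-rot-core A k p q r s w v q+1+p≡A r<k w++v≡ w++E∷v≡ alt≡ with ++E≡NᵖE (suc q) w v _ (sym w++E∷v≡)
  ... | inj₁ (refl , _) = <-irrefl (sym k≡0) (≤-<-trans z≤n r<k)
    where
    k≡0 : k ≡ 0
    k≡0 = begin
      k                                                           ≡⟨ sym (+-identityʳ k) ⟩
      k + 0                                                       ≡⟨ sym (rise-Nⁿ⁺¹-to-A A k p q [] (trans (+-comm p (suc q)) q+1+p≡A)) ⟩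
      rise (deltaK (suc A) k) p (replicate (suc q) N ++ [])       ≡⟨ cong (rise (deltaK (suc A) k) p) (++-identityʳ (replicate (suc q) N)) ⟩
      rise (deltaK (suc A) k) p (replicate (suc q) N)             ≡⟨ sym (rise-after-Nᵖ (deltaK (suc A) k) p (replicate (suc q) N)) ⟩
      rise (deltaK (suc A) k) (countN (replicate p N)) (replicate (suc q) N)  ≡⟨ returns⇒balanced (deltaK (suc A) k) (replicate p N) _ alt≡ ⟩
      countE (replicate (suc q) N)                                ≡⟨ countE-Nⁿ (suc q) ⟩
      0                                                           ∎
  ... | inj₂ (w′ , refl) with Eʳ-prefix r w′ v (replicate s E) w′E∷v≡ E∷w′v≡
    where
    E∷w′v≡ : E ∷ w′ ++ v ≡ replicate r E ++ N ∷ replicate s E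
    E∷w′v≡ = ++-cancelˡ (replicate (suc q) N) _ _ (trans (sym (++-assoc (replicate (suc q) N) (E ∷ w′) v)) w++v≡)
    w′E∷v≡ : w′ ++ E ∷ v ≡ replicate r E ++ N ∷ replicate s E
    w′E∷v≡ = sym (proj₂ (∷-injective (++-cancelˡ (replicate (suc q) N) _ _ (trans w++E∷v≡ (++-assoc (replicate (suc q) N) (E ∷ w′) (E ∷ v))))))
  ... | j , j<r , refl = <-irrefl (sym k≡j+1) (≤-<-trans j<r r<k)
    where
    k≡j+1 : k ≡ suc j
    k≡j+1 = begin
      k                                                     ≡⟨ sym (+-identityʳ k) ⟩
      k + 0                                                 ≡⟨ cong (k +_) (sym (rise-Eⁿ _ A (suc j))) ⟩
      k + rise (deltaK (suc A) k) A (replicate (suc j) E)   ≡⟨ sym (rise-Nⁿ⁺¹-to-A A k p q _ (trans (+-comm p (suc q)) q+1+p≡A)) ⟩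
      rise (deltaK (suc A) k) p (replicate (suc q) N ++ E ∷ replicate j E)   ≡⟨ sym (rise-after-Nᵖ (deltaK (suc A) k) p (replicate (suc q) N ++ E ∷ replicate j E)) ⟩
      rise (deltaK (suc A) k) (countN (replicate p N)) (replicate (suc q) N ++ E ∷ replicate j E)   ≡⟨ returns⇒balanced (deltaK (suc A) k) (replicate p N) _ alt≡ ⟩
      countE (replicate (suc q) N ++ E ∷ replicate j E)     ≡⟨ countE-++ (replicate (suc q) N) _ ⟩
      countE (replicate (suc q) N) + suc (countE (replicate j E)) ≡⟨ cong₂ (λ a b → a + suc b) (countE-Nⁿ (suc q)) (countE-Eⁿ j) ⟩
      suc j                                                 ∎

no-rot-below-to-at : ∀ A k p q r s → suc q + p ≡ A → r < k → ¬ Rot (deltaK (suc A) k) (zigzag p (suc q) r s) (zigzag A 0 r s)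
no-rot-below-to-at A k p q r s q+1+p≡A r<k (u , w , v , μ≡ , _ , alt≡ , _ , μ′≡)
  with ++E≡NᵖE p u (w ++ v) (replicate (suc q) N ++ replicate r E ++ N ∷ replicate s E) (sym μ≡)
... | inj₂ (u′ , refl) = NᵖE≢Nᵖ⁺ᵐ⁺¹ p q _ (E ∷ replicate r E ++ N ∷ replicate s E)
      (sym (trans (cong (λ a → replicate a N ++ E ∷ replicate r E ++ N ∷ replicate s E) p+q+1≡A) (trans μ′≡ (++-assoc (replicate p N) (E ∷ u′) _))))
  where p+q+1≡A = trans (+-comm p (suc q)) q+1+p≡A
... | inj₁ (refl , w++v≡) = no-rot-core A k p q r s w v q+1+p≡A r<k w++v≡ w++E∷v≡ alt≡
  where
  w++E∷v≡ : replicate (suc q) N ++ E ∷ replicate r E ++ N ∷ replicate s E ≡ w ++ E ∷ v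
  w++E∷v≡ = ++-cancelˡ (replicate p N) _ _ (begin
    replicate p N ++ replicate (suc q) N ++ E ∷ _   ≡⟨ sym (++-assoc (replicate p N) _ _) ⟩
    (replicate p N ++ replicate (suc q) N) ++ E ∷ _ ≡⟨ cong (_++ E ∷ replicate r E ++ N ∷ replicate s E) (sym (replicate-+ p (suc q) N)) ⟩
    replicate (p + suc q) N ++ E ∷ _                ≡⟨ cong (λ a → replicate a N ++ E ∷ replicate r E ++ N ∷ replicate s E) (trans (+-comm p (suc q)) q+1+p≡A) ⟩
    zigzag A 0 r s                                  ≡⟨ μ′≡ ⟩
    replicate p N ++ w ++ E ∷ v                     ∎)

trailE-zigzag : ∀ p q r s → trailE (zigzag p q r s) ≡ s
trailE-zigzag p q r s = trans (cong trailE (sym reassoc)) (trailE-++-N-Eᵇ (replicate p N ++ E ∷ replicate q N ++ replicate r E) s)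
  where
  reassoc : (replicate p N ++ E ∷ replicate q N ++ replicate r E) ++ N ∷ replicate s E ≡ zigzag p q r s
  reassoc = trans (++-assoc (replicate p N) _ _) (cong (λ w → replicate p N ++ E ∷ w) (++-assoc (replicate q N) (replicate r E) _))

module Order (C A k : ℕ) (A≡0⇒k≡0 : A ≡ 0 → k ≡ 0) where

  B : ℕ
  B = C + k

  δ : ℕ → ℕ
  δ = deltaK (suc A) k

  -- the ν-paths, those whose first E step is at height A split by comparing r with k,
  -- so that (σS , σT) is their simplified bracket vector (simp≡σ)
  data Shape : Set where
    below  : (p q r s : ℕ) → suc q + p ≡ A → r + s ≡ B → Shape
    atHigh : (r s : ℕ) → k ≤ r → r + s ≡ B → Shape
    atLow  : (r s : ℕ) → r < k → r + s ≡ B → Shape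
    top    : Shape

  path : Shape → Path
  path (below p q r s _ _) = zigzag p (suc q) r s
  path (atHigh r s _ _)    = zigzag A 0 r s
  path (atLow r s _ _)     = zigzag A 0 r s
  path top                 = corner (suc A) (suc B)

  σS : Shape → ℕ
  σS (below p _ _ _ _ _) = p
  σS (atHigh _ _ _ _)    = A
  σS (atLow _ _ _ _)     = suc A
  σS top                 = suc A

  σT : Shape → ℕ
  σT (below _ _ _ s _ _) = s
  σT (atHigh _ s _ _)    = s
  σT (atLow _ s _ _)     = pred s
  σT top                 = B

  refine : (c : NuPath A B) → Σ Shape λ d → toPath c ≡ path d
  refine (below p q r s q+1+p≡A r+s≡B) = below p q r s q+1+p≡A r+s≡B , refl
  refine (at r s r+s≡B) with k ≤? r
  ... | yes k≤r = atHigh r s k≤r r+s≡B , refl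
  ... | no k≰r  = atLow r s (≰⇒> k≰r) r+s≡B , refl
  refine top = top , refl

  shapeOf : ∀ μ → IsNuPath (nu (suc A) (suc B)) μ → Σ Shape λ d → μ ≡ path d
  shapeOf μ isNu with classify A B μ isNu
  ... | c , μ≡ with refine c
  ... | d , c≡ = d , trans μ≡ c≡

  path-isNuPath : ∀ d → IsNuPath (nu (suc A) (suc B)) (path d)
  path-isNuPath (below p q r s q+1+p≡A r+s≡B) = toPath-isNuPath A B (below p q r s q+1+p≡A r+s≡B)
  path-isNuPath (atHigh r s _ r+s≡B)          = toPath-isNuPath A B (at r s r+s≡B)
  path-isNuPath (atLow r s _ r+s≡B)           = toPath-isNuPath A B (at r s r+s≡B)
  path-isNuPath top                           = toPath-isNuPath A B top

  simp≡σ : ∀ d → simpS (suc A) (suc B) k (path d) ≡ σS d × simpT (suc A) (suc B) k (path d) ≡ σT d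
  simp≡σ (below p q r s q+1+p≡A r+s≡B) =
    simp-below C A k A≡0⇒k≡0 (zigzag p (suc q) r s) p r s p<A
      (λ i i<A i≢p → ≤-reflexive (countVal-zigzag-other i p (suc q) r s (subst (i <_) (sym q+1+p≡A) i<A) i≢p))
      (countVal-zigzag-first p q r s)
      (subst (λ a → countVal a (ys (zigzag p (suc q) r s)) ≡ suc r) q+1+p≡A (countVal-zigzag-second p q r s))
      (subst (λ a → countVal (suc a) (ys (zigzag p (suc q) r s)) ≡ suc s) q+1+p≡A (countVal-zigzag-top p (suc q) r s))
      r+s≡B
    where p<A = subst (p <_) q+1+p≡A (s≤s (m≤n+m p q))
  simp≡σ (atHigh r s k≤r r+s≡B) =
    simp-at-> C A k A≡0⇒k≡0 (zigzag A 0 r s) (suc r) s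
      (λ i i<A → ≤-reflexive (countVal-zigzag-other i A 0 r s i<A (<⇒≢ i<A)))
      (countVal-zigzag-flat A r s) (countVal-zigzag-top A 0 r s) (cong suc r+s≡B) (s≤s k≤r)
  simp≡σ (atLow r s r<k r+s≡B) =
    simp-at-≤ C A k A≡0⇒k≡0 (zigzag A 0 r s) (suc r) s
      (λ i i<A → ≤-reflexive (countVal-zigzag-other i A 0 r s i<A (<⇒≢ i<A)))
      (countVal-zigzag-flat A r s) (countVal-zigzag-top A 0 r s) (cong suc r+s≡B) r<k
  simp≡σ top =
    simp-at-≤ C A k A≡0⇒k≡0 (corner (suc A) (suc B)) 0 (suc B)
      (λ i i<A → ≤-reflexive (countVal-corner-≤ i (suc A) (suc B) (m<n⇒m<1+n i<A)))
      (countVal-corner-≤ A (suc A) (suc B) (n<1+n A)) (countVal-corner-top (suc A) (suc B)) refl z≤n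

  σS-below : ∀ p q → suc q + p ≡ A → p < A
  σS-below p q q+1+p≡A = subst (p <_) q+1+p≡A (s≤s (m≤n+m p q))

  σ-bounded : ∀ d → σS d ≤ suc A × σT d ≤ B
  σ-bounded (below p q r s q+1+p≡A r+s≡B) = <⇒≤ (m<n⇒m<1+n (σS-below p q q+1+p≡A)) , subst (s ≤_) r+s≡B (m≤n+m s r)
  σ-bounded (atHigh r s _ r+s≡B) = n≤1+n A , subst (s ≤_) r+s≡B (m≤n+m s r)
  σ-bounded (atLow r s _ r+s≡B)  = ≤-refl , ≤-trans pred[n]≤n (subst (s ≤_) r+s≡B (m≤n+m s r))
  σ-bounded top                  = ≤-refl , ≤-refl

  lead : Shape → ℕ
  lead (below p _ _ _ _ _) = p
  lead (atHigh _ _ _ _)    = A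
  lead (atLow _ _ _ _)     = A
  lead top                 = suc A

  trail : Shape → ℕ
  trail (below _ _ _ s _ _) = s
  trail (atHigh _ s _ _)    = s
  trail (atLow _ s _ _)     = s
  trail top                 = suc B

  leadN-path : ∀ d → leadN (path d) ≡ lead d
  leadN-path (below p q r s _ _) = leadN-Nᵃ-++-E p _
  leadN-path (atHigh r s _ _)    = leadN-Nᵃ-++-E A _
  leadN-path (atLow r s _ _)     = leadN-Nᵃ-++-E A _
  leadN-path top                 = leadN-Nᵃ-++-E (suc A) _

  trailE-path : ∀ d → trailE (path d) ≡ trail d
  trailE-path (below p q r s _ _) = trailE-zigzag p (suc q) r s
  trailE-path (atHigh r s _ _)    = trailE-zigzag A 0 r s
  trailE-path (atLow r s _ _)     = trailE-zigzag A 0 r s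
  trailE-path top                 = trans (cong trailE (sym (replicate-++-∷ A N (replicate (suc B) E)))) (trailE-++-N-Eᵇ (replicate A N) (suc B))

  rot-lead-trail : ∀ d d′ → Rot δ (path d) (path d′) → lead d ≤ lead d′ × trail d ≤ trail d′
  rot-lead-trail d d′ rot with rot-leadN-trailE δ (path d) (path d′) rot
  ... | leadN≤ , trailE≤ = subst₂ _≤_ (leadN-path d) (leadN-path d′) leadN≤ , subst₂ _≤_ (trailE-path d) (trailE-path d′) trailE≤

  private
    sum-antitone : ∀ {r s r′ s′} → r + s ≡ B → r′ + s′ ≡ B → s ≤ s′ → r′ ≤ r
    sum-antitone {r} {s} {r′} {s′} r+s≡B r′+s′≡B s≤s′ =
      +-cancelʳ-≤ s r′ r (≤-trans (+-monoʳ-≤ r′ s≤s′) (≤-reflexive (trans r′+s′≡B (sym r+s≡B))))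

    sum-strict : ∀ {r s r′ s′} → r + s ≡ B → r′ + s′ ≡ B → r′ < r → s < s′
    sum-strict {r} {s} {r′} {s′} r+s≡B r′+s′≡B r′<r = ≰⇒> λ s′≤s → <-irrefl (trans r′+s′≡B (sym r+s≡B)) (+-mono-<-≤ r′<r s′≤s)

    sum-cancel : ∀ {r s r′} → r + s ≡ B → r′ + s ≡ B → r ≡ r′
    sum-cancel {r} {s} {r′} r+s≡B r′+s≡B = +-cancelʳ-≡ s r r′ (trans r+s≡B (sym r′+s≡B))

  private
    σ-monotone′ : ∀ d d′ → lead d ≤ lead d′ × trail d ≤ trail d′ → Rot δ (path d) (path d′) → σS d ≤ σS d′ × σT d ≤ σT d′
    σ-monotone′ d top _ _ = σ-bounded d
    σ-monotone′ (below _ _ _ _ _ _) (below _ _ _ _ _ _) lt _ = lt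
    σ-monotone′ (below p q _ _ q+1+p≡A _) (atHigh _ _ _ _) (_ , s≤s′) _ = <⇒≤ (σS-below p q q+1+p≡A) , s≤s′
    σ-monotone′ (below p q r s q+1+p≡A r+s≡B) (atLow r′ s′ r′<k r′+s′≡B) (_ , s≤s′) rot with s ≟ s′
    ... | yes refl = ⊥-elim (no-rot-below-to-at A k p q r s q+1+p≡A (subst (_< k) (sym r≡r′) r′<k) (subst (λ x → Rot δ _ (zigzag A 0 x s)) (sym r≡r′) rot))
      where r≡r′ = sum-cancel r+s≡B r′+s′≡B
    ... | no s≢s′ = <⇒≤ (m<n⇒m<1+n (σS-below p q q+1+p≡A)) , <⇒≤pred (≤∧≢⇒< s≤s′ s≢s′)
    σ-monotone′ (atHigh _ _ _ _) (atHigh _ _ _ _) (_ , s≤s′) _ = ≤-refl , s≤s′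
    σ-monotone′ (atHigh r s k≤r r+s≡B) (atLow r′ s′ r′<k r′+s′≡B) _ _ = n≤1+n A , <⇒≤pred (sum-strict r+s≡B r′+s′≡B (<-≤-trans r′<k k≤r))
    σ-monotone′ (atLow r s r<k r+s≡B) (atHigh r′ s′ k≤r′ r′+s′≡B) (_ , s≤s′) _ =
      ⊥-elim (<-irrefl refl (<-≤-trans r<k (≤-trans k≤r′ (sum-antitone r+s≡B r′+s′≡B s≤s′))))
    σ-monotone′ (atLow _ _ _ _) (atLow _ _ _ _) (_ , s≤s′) _ = ≤-refl , pred-mono-≤ s≤s′
    σ-monotone′ (atHigh _ _ _ _) (below p′ q′ _ _ q′+1+p′≡A _) (A≤p′ , _) _ = ⊥-elim (<-irrefl refl (<-≤-trans (σS-below p′ q′ q′+1+p′≡A) A≤p′))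
    σ-monotone′ (atLow _ _ _ _) (below p′ q′ _ _ q′+1+p′≡A _) (A≤p′ , _) _ = ⊥-elim (<-irrefl refl (<-≤-trans (σS-below p′ q′ q′+1+p′≡A) A≤p′))
    σ-monotone′ top (below p′ q′ _ _ q′+1+p′≡A _) (A<p′ , _) _ = ⊥-elim (<-irrefl refl (<-≤-trans (m<n⇒m<1+n (σS-below p′ q′ q′+1+p′≡A)) A<p′))
    σ-monotone′ top (atHigh _ _ _ _) (A<A , _) _ = ⊥-elim (<-irrefl refl A<A)
    σ-monotone′ top (atLow _ _ _ _) (A<A , _) _ = ⊥-elim (<-irrefl refl A<A)

  σ-monotone : ∀ d d′ → Rot δ (path d) (path d′) → σS d ≤ σS d′ × σT d ≤ σT d′
  σ-monotone d d′ rot = σ-monotone′ d d′ (rot-lead-trail d d′ rot) rot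

  private
    C<s : ∀ {r s} → r < k → r + s ≡ B → C < s
    C<s {r} {s} r<k r+s≡B = ≰⇒> λ s≤C → <-irrefl (trans r+s≡B (+-comm C k)) (+-mono-<-≤ r<k s≤C)

    s≤C : ∀ {r s} → k ≤ r → r + s ≡ B → s ≤ C
    s≤C {r} {s} k≤r r+s≡B = +-cancelʳ-≤ k s C (≤-trans (+-monoʳ-≤ s k≤r) (≤-reflexive (trans (+-comm s r) r+s≡B)))

    C≤s : ∀ {r s} → r ≤ k → r + s ≡ B → C ≤ s
    C≤s {r} {s} r≤k r+s≡B = +-cancelʳ-≤ k C s (≤-trans (≤-reflexive (sym r+s≡B)) (≤-trans (+-monoˡ-≤ s r≤k) (≤-reflexive (+-comm k s))))

    suc-pred-C< : ∀ {n} → C < n → suc (pred n) ≡ n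
    suc-pred-C< {suc n} _ = refl

    pred<⇒≤ : ∀ {s t} → 1 ≤ s → pred s < t → s ≤ t
    pred<⇒≤ {suc s} _ s<t = s<t

    pred<B : ∀ {r s} → r < k → r + s ≡ B → pred s < B
    pred<B {r} {zero}  r<k r+0≡B = ⊥-elim (<-irrefl refl (<-≤-trans (C<s r<k r+0≡B) z≤n))
    pred<B {r} {suc s} _   r+s≡B = subst (suc s ≤_) r+s≡B (m≤n+m (suc s) r)

    σS>A : ∀ d′ → A ≤ σS d′ → C < σT d′ → suc A ≤ σS d′
    σS>A (below p q _ _ q+1+p≡A _) A≤p _    = ⊥-elim (<-irrefl refl (<-≤-trans (σS-below p q q+1+p≡A) A≤p))
    σS>A (atHigh _ _ k≤r r+s≡B)    _   C<s′ = ⊥-elim (<-irrefl refl (<-≤-trans C<s′ (s≤C k≤r r+s≡B)))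
    σS>A (atLow _ _ _ _)           _   _    = ≤-refl
    σS>A top                       _   _    = ≤-refl

  σ-injective : ∀ d d′ → σS d ≡ σS d′ → σT d ≡ σT d′ → path d ≡ path d′
  σ-injective (below p q r s q+1+p≡A r+s≡B) (below .p q′ r′ .s q′+1+p≡A r′+s≡B) refl refl
    with +-cancelʳ-≡ p q q′ (suc-injective (trans q+1+p≡A (sym q′+1+p≡A))) | sum-cancel {r} {s} {r′} r+s≡B r′+s≡B
  ... | refl | refl = refl
  σ-injective (atHigh r s _ r+s≡B) (atHigh r′ .s _ r′+s≡B) _ refl with sum-cancel {r} {s} {r′} r+s≡B r′+s≡B
  ... | refl = refl
  σ-injective (atLow r s r<k r+s≡B) (atLow r′ s′ r′<k r′+s′≡B) _ pred≡
    with trans (sym (suc-pred-C< (C<s r<k r+s≡B))) (trans (cong suc pred≡) (suc-pred-C< (C<s r′<k r′+s′≡B)))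
  ... | refl with sum-cancel {r} {s} {r′} r+s≡B r′+s′≡B
  ... | refl = refl
  σ-injective top top _ _ = refl
  σ-injective (below p q _ _ q+1+p≡A _) (atHigh _ _ _ _) p≡A _ = ⊥-elim (<-irrefl p≡A (σS-below p q q+1+p≡A))
  σ-injective (below p q _ _ q+1+p≡A _) (atLow _ _ _ _) p≡A+1 _ = ⊥-elim (<-irrefl p≡A+1 (m<n⇒m<1+n (σS-below p q q+1+p≡A)))
  σ-injective (below p q _ _ q+1+p≡A _) top p≡A+1 _ = ⊥-elim (<-irrefl p≡A+1 (m<n⇒m<1+n (σS-below p q q+1+p≡A)))
  σ-injective (atHigh _ _ _ _) (below p q _ _ q+1+p≡A _) A≡p _ = ⊥-elim (<-irrefl (sym A≡p) (σS-below p q q+1+p≡A))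
  σ-injective (atLow _ _ _ _) (below p q _ _ q+1+p≡A _) A+1≡p _ = ⊥-elim (<-irrefl (sym A+1≡p) (m<n⇒m<1+n (σS-below p q q+1+p≡A)))
  σ-injective top (below p q _ _ q+1+p≡A _) A+1≡p _ = ⊥-elim (<-irrefl (sym A+1≡p) (m<n⇒m<1+n (σS-below p q q+1+p≡A)))
  σ-injective (atHigh _ _ _ _) (atLow _ _ _ _) A≡A+1 _ = ⊥-elim (<-irrefl A≡A+1 (n<1+n A))
  σ-injective (atHigh _ _ _ _) top A≡A+1 _ = ⊥-elim (<-irrefl A≡A+1 (n<1+n A))
  σ-injective (atLow _ _ _ _) (atHigh _ _ _ _) A+1≡A _ = ⊥-elim (<-irrefl (sym A+1≡A) (n<1+n A))
  σ-injective top (atHigh _ _ _ _) A+1≡A _ = ⊥-elim (<-irrefl (sym A+1≡A) (n<1+n A))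
  σ-injective (atLow r s r<k r+s≡B) top _ pred-s≡B = ⊥-elim (<-irrefl pred-s≡B (pred<B r<k r+s≡B))
  σ-injective top (atLow r s r<k r+s≡B) _ B≡pred-s = ⊥-elim (<-irrefl (sym B≡pred-s) (pred<B r<k r+s≡B))

  potential : Shape → ℕ
  potential (below _ q r _ _ _) = suc (suc (r + q))
  potential (atHigh r _ _ _)    = suc r
  potential (atLow r _ _ _)     = suc r
  potential top                 = 0

  data Progress (d d′ : Shape) : Set where
    arrived : path d ≡ path d′ → Progress d d′
    via     : ∀ d″ → Rot δ (path d) (path d″) → potential d″ < potential d → σS d″ ≤ σS d′ → σT d″ ≤ σT d′ → Progress d d′

  private
    shift-at : ∀ r s → Rot δ (zigzag A 0 (suc r) s) (zigzag A 0 r (suc s))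
    shift-at r s = rot-shiftE A k A 0 r s refl

    at-top : ∀ s → 0 + s ≡ B → Rot δ (zigzag A 0 0 s) (corner (suc A) (suc B))
    at-top s refl = rot-at-top A k s

  step-T : ∀ d d′ → σS d ≤ σS d′ → σT d < σT d′ → Progress d d′
  step-T (below _ _ zero s _ s≡B) d′ _ s< = ⊥-elim (<-irrefl refl (<-≤-trans s< (subst (σT d′ ≤_) (sym s≡B) (proj₂ (σ-bounded d′)))))
  step-T (below p q (suc r) s q+1+p≡A r+1+s≡B) d′ S≤ s< =
    via (below p q r (suc s) q+1+p≡A (trans (+-suc r s) r+1+s≡B)) (rot-shiftE A k p (suc q) r s q+1+p≡A) ≤-refl S≤ s<
  step-T (atHigh zero s _ s≡B) d′ _ s< = ⊥-elim (<-irrefl refl (<-≤-trans s< (subst (σT d′ ≤_) (sym s≡B) (proj₂ (σ-bounded d′)))))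
  step-T (atHigh (suc r) s k≤r+1 r+1+s≡B) d′ A≤ s< with k ≤? r
  ... | yes k≤r = via (atHigh r (suc s) k≤r (trans (+-suc r s) r+1+s≡B)) (shift-at r s) ≤-refl A≤ s<
  ... | no k≰r  = via (atLow r (suc s) (≰⇒> k≰r) (trans (+-suc r s) r+1+s≡B)) (shift-at r s) ≤-refl
                      (σS>A d′ A≤ (≤-<-trans (C≤s (≰⇒> k≰r) r+1+s≡B) s<)) (<⇒≤ s<)
  step-T (atLow zero s 0<k s≡B) d′ A+1≤ pred-s< =
    via top (at-top s s≡B) (s≤s z≤n) A+1≤ (subst (_≤ σT d′) s≡B (pred<⇒≤ (≤-<-trans z≤n (C<s 0<k s≡B)) pred-s<))
  step-T (atLow (suc r) s r+1<k r+1+s≡B) d′ A+1≤ pred-s< =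
    via (atLow r (suc s) (<-trans (n<1+n r) r+1<k) (trans (+-suc r s) r+1+s≡B)) (shift-at r s) ≤-refl A+1≤
        (pred<⇒≤ (≤-<-trans z≤n (C<s r+1<k r+1+s≡B)) pred-s<)
  step-T top d′ _ B< = ⊥-elim (<-irrefl refl (<-≤-trans B< (proj₂ (σ-bounded d′))))

  step-S : ∀ d d′ → σS d < σS d′ → σT d ≡ σT d′ → Progress d d′
  step-S (below p (suc q) r s q+2+p≡A r+s≡B) d′ p< s≡ =
    via (below (suc p) q r s (trans (+-suc (suc q) p) q+2+p≡A) r+s≡B) (rot-firstN A k p q r s q+2+p≡A)
        (s≤s (s≤s (≤-reflexive (sym (+-suc r q))))) p< (≤-reflexive s≡)
  step-S (below p zero r s p+1≡A r+s≡B) d′ p< s≡ with k ≤? r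
  ... | yes k≤r = via (atHigh r s k≤r r+s≡B) (rot-to-at A k p r s p+1≡A k≤r)
                      (s≤s (s≤s (≤-reflexive (sym (+-identityʳ r))))) (subst (_≤ σS d′) p+1≡A p<) (≤-reflexive s≡)
  ... | no k≰r = past-A r (≰⇒> k≰r) r+s≡B
    where
    A+1≤ : ∀ {r} → r < k → r + s ≡ B → suc A ≤ σS d′
    A+1≤ r<k r+s≡B = σS>A d′ (subst (_≤ σS d′) p+1≡A p<) (subst (C <_) s≡ (C<s r<k r+s≡B))
    past-A : ∀ r → r < k → (r+s≡B : r + s ≡ B) → Progress (below p zero r s p+1≡A r+s≡B) d′
    past-A zero 0<k s≡B = via top (subst (λ x → Rot δ (zigzag p 1 0 x) _) (sym s≡B) (rot-to-top A k p B p+1≡A 0<k (m≤n+m k C)))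
                              (s≤s z≤n) (A+1≤ 0<k s≡B) (≤-reflexive (trans (sym s≡B) s≡))
    past-A (suc r) r+1<k r+1+s≡B =
      via (atLow r (suc s) (<-trans (n<1+n r) r+1<k) (trans (+-suc r s) r+1+s≡B))
          (rot-past-A A k p r s p+1≡A r+1<k (subst (k ≤_) (sym r+1+s≡B) (m≤n+m k C)))
          (s≤s (≤-trans (≤-reflexive (sym (+-identityʳ (suc r)))) (n≤1+n _))) (A+1≤ r+1<k r+1+s≡B) (≤-reflexive s≡)
  step-S (atHigh _ _ _ _) (below p′ q′ _ _ q′+1+p′≡A _) A<p′ _ = ⊥-elim (<-irrefl refl (<-trans A<p′ (σS-below p′ q′ q′+1+p′≡A)))
  step-S (atHigh _ _ _ _) (atHigh _ _ _ _) A<A _ = ⊥-elim (<-irrefl refl A<A)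
  step-S (atHigh zero s _ s≡B) (atLow r′ s′ r′<k r′+s′≡B) _ s≡pred-s′ = ⊥-elim (<-irrefl (trans (sym s≡pred-s′) s≡B) (pred<B r′<k r′+s′≡B))
  step-S (atHigh (suc r) s _ r+1+s≡B) (atLow r′ s′ r′<k r′+s′≡B) _ s≡pred-s′ =
    via (atLow r (suc s) r<k (trans (+-suc r s) r+1+s≡B)) (shift-at r s) ≤-refl ≤-refl (≤-reflexive s≡pred-s′)
    where
    s′≡s+1 : s′ ≡ suc s
    s′≡s+1 = trans (sym (suc-pred-C< (C<s r′<k r′+s′≡B))) (cong suc (sym s≡pred-s′))
    r<k : r < k
    r<k = subst (_< k) (sum-cancel {r′} {s′} {r} r′+s′≡B (trans (cong (r +_) s′≡s+1) (trans (+-suc r s) r+1+s≡B))) r′<k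
  step-S (atHigh zero s _ s≡B) top _ _ = via top (at-top s s≡B) (s≤s z≤n) ≤-refl ≤-refl
  step-S (atHigh (suc r) s _ r+1+s≡B) top _ s≡B = ⊥-elim (<-irrefl (trans s≡B (sym r+1+s≡B)) (s≤s (m≤n+m s r)))
  step-S (atLow _ _ _ _) d′ A+1< _ = ⊥-elim (<-irrefl refl (<-≤-trans A+1< (proj₁ (σ-bounded d′))))
  step-S top d′ A+1< _ = ⊥-elim (<-irrefl refl (<-≤-trans A+1< (proj₁ (σ-bounded d′))))

  progress : ∀ d d′ → σS d ≤ σS d′ → σT d ≤ σT d′ → Progress d d′
  progress d d′ S≤ T≤ with σT d <? σT d′ | σS d <? σS d′
  ... | yes T< | _      = step-T d d′ S≤ T<
  ... | no T≮  | yes S< = step-S d d′ S< (≤-antisym T≤ (≮⇒≥ T≮))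
  ... | no T≮  | no S≮  = arrived (σ-injective d d′ (≤-antisym S≤ (≮⇒≥ S≮)) (≤-antisym T≤ (≮⇒≥ T≮)))

  reach : ∀ n d d′ → potential d ≤ n → σS d ≤ σS d′ → σT d ≤ σT d′ → HLeq (suc A) (suc B) k (path d) (path d′)
  reach n d d′ pot≤ S≤ T≤ with progress d d′ S≤ T≤
  ... | arrived path≡ = subst (HLeq (suc A) (suc B) k (path d)) path≡ ε
  ... | via d″ rot pot< S″≤ T″≤ with n
  ...   | zero  = ⊥-elim (<-irrefl refl (<-≤-trans pot< (≤-trans pot≤ z≤n)))
  ...   | suc n = (path-isNuPath d , path-isNuPath d″ , rot) ◅ reach n d″ d′ (s≤s⁻¹ (≤-trans pot< pot≤)) S″≤ T″≤

  Simplified≤ : Path → Path → Set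
  Simplified≤ μ₁ μ₂ = simpS (suc A) (suc B) k μ₁ ≤ simpS (suc A) (suc B) k μ₂ × simpT (suc A) (suc B) k μ₁ ≤ simpT (suc A) (suc B) k μ₂

  cover-monotone : ∀ μ μ′ → HCover (suc A) (suc B) k μ μ′ → Simplified≤ μ μ′
  cover-monotone μ μ′ (isNu , isNu′ , rot) with shapeOf μ isNu | shapeOf μ′ isNu′
  ... | d , refl | d′ , refl with σ-monotone d d′ rot | simp≡σ d | simp≡σ d′
  ... | S≤ , T≤ | S≡ , T≡ | S≡′ , T≡′ = subst₂ _≤_ (sym S≡) (sym S≡′) S≤ , subst₂ _≤_ (sym T≡) (sym T≡′) T≤

  HLeq⇒Simplified≤ : ∀ μ₁ μ₂ → HLeq (suc A) (suc B) k μ₁ μ₂ → Simplified≤ μ₁ μ₂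
  HLeq⇒Simplified≤ μ₁ .μ₁ ε = ≤-refl , ≤-refl
  HLeq⇒Simplified≤ μ₁ μ₂ (_◅_ {j = μ} cover rest) with cover-monotone μ₁ μ cover | HLeq⇒Simplified≤ μ μ₂ rest
  ... | S≤ , T≤ | S≤′ , T≤′ = ≤-trans S≤ S≤′ , ≤-trans T≤ T≤′

  Simplified≤⇒HLeq : ∀ μ₁ μ₂ → IsNuPath (nu (suc A) (suc B)) μ₁ → IsNuPath (nu (suc A) (suc B)) μ₂ →
    Simplified≤ μ₁ μ₂ → HLeq (suc A) (suc B) k μ₁ μ₂
  Simplified≤⇒HLeq μ₁ μ₂ isNu₁ isNu₂ (S≤ , T≤) with shapeOf μ₁ isNu₁ | shapeOf μ₂ isNu₂
  ... | d , refl | d′ , refl with simp≡σ d | simp≡σ d′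
  ... | S≡ , T≡ | S≡′ , T≡′ = reach (potential d) d d′ ≤-refl (subst₂ _≤_ S≡ S≡′ S≤) (subst₂ _≤_ T≡ T≡′ T≤)

  HLeq⇔Simplified≤ : ∀ μ₁ μ₂ → IsNuPath (nu (suc A) (suc B)) μ₁ → IsNuPath (nu (suc A) (suc B)) μ₂ →
    HLeq (suc A) (suc B) k μ₁ μ₂ ⇔ Simplified≤ μ₁ μ₂
  HLeq⇔Simplified≤ μ₁ μ₂ isNu₁ isNu₂ = mk⇔ (HLeq⇒Simplified≤ μ₁ μ₂) (Simplified≤⇒HLeq μ₁ μ₂ isNu₁ isNu₂)

lemma3p3 : (a b k : ℕ) → 1 ≤ a → 1 ≤ b → k < b → (a ≡ 1 → k ≡ 0) →
    (μ₁ μ₂ : Path) → IsNuPath (nu a b) μ₁ → IsNuPath (nu a b) μ₂ →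
    (HLeq a b k μ₁ μ₂ ⇔ (simpS a b k μ₁ ≤ simpS a b k μ₂ × simpT a b k μ₁ ≤ simpT a b k μ₂))
lemma3p3 (suc A) (suc B) k (s≤s z≤n) (s≤s z≤n) k<b a≡1⇒k≡0 = with-B≡C+k B (B ∸ k) (sym (m∸n+n≡m (s≤s⁻¹ k<b)))
  where
  with-B≡C+k : ∀ B C → B ≡ C + k → (μ₁ μ₂ : Path) → IsNuPath (nu (suc A) (suc B)) μ₁ → IsNuPath (nu (suc A) (suc B)) μ₂ →
    (HLeq (suc A) (suc B) k μ₁ μ₂ ⇔
      (simpS (suc A) (suc B) k μ₁ ≤ simpS (suc A) (suc B) k μ₂ × simpT (suc A) (suc B) k μ₁ ≤ simpT (suc A) (suc B) k μ₂))
  with-B≡C+k .(C + k) C refl = Order.HLeq⇔Simplified≤ C A k (λ A≡0 → a≡1⇒k≡0 (cong suc A≡0))
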